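{- Let $p$ be a prime and $d$ an integer with $0 \le d \le p-1$. The sequence $$0 \to V_d(\mathbb{F}_p) \xrightarrow{\iota} U_d(\mathbb{F}_p) \xrightarrow{\phi} V_{p-1-d}(\mathbb{F}_p) \to 0$$ is exact. Moreover, for every $M \in \mathrm{Mat}_2(\mathbb{Z})_{\neq 0}$ whose reduction modulo $p$ is invertible one has $\iota(M.P) = M.\iota(P)$ and $\phi(M.f) = \det(M)^d\, M.\phi(f)$ for all $P \in V_d(\mathbb{F}_p)$, $f \in U_d(\mathbb{F}_p)$. If $d>0$, the same two identities hold for $M = \begin{pmatrix}p&0\\0&1\end{pmatrix}$; in particular then $\phi(M.f) = 0$ for all $f$.
   Context: $V_n(\mathbb{F}_p) = \mathrm{Sym}^n(\mathbb{F}_p^2)\cong\mathbb{F}_p[X,Y]_n$ with left action $(M.P)(X,Y) = P(aX+cY,bX+dY)$ for $M = \begin{pmatrix}a&b\\c&d\end{pmatrix}\in\mathrm{Mat}_2(\mathbb{Z})_{\neq0}$. Let $\mathcal{W}(p,\mathbb{F}_p)$ be the space of functions $f:\mathbb{F}_p^2\to\mathbb{F}_p$ with $f(0,0)=0$, with left action $(M.f)(x,y) = f((x,y)M)$ (row vector times $M$ mod $p$). $U_d(\mathbb{F}_p) = \{f\in\mathcal{W}(p,\mathbb{F}_p): f(lx,ly) = l^d f(x,y)\ \forall l\in\mathbb{F}_p^*\}$ (so $U_{p-1} = U_0$). The map $\iota$ sends a homogeneous polynomial $P$ of degree $d$ to the function equal to $P(x,y)$ at $(x,y)\neq(0,0)$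 and $0$ at $(0,0)$. On $\mathcal{W}(p,\mathbb{F}_p)$ there is the pairing $\langle f,g\rangle = \sum_{v\in\mathbb{F}_p^2} f(v)g(v)$. For $m \le p-1$, $V_m(\mathbb{F}_p)$ carries the perfect pairing $\langle\cdot,\cdot\rangle_m$ obtained from the pairing $\langle v,w\rangle = \det(v|w)$ on column vectors in $\mathbb{F}_p^2$ by taking its $m$-th tensor power and restricting to $\mathrm{Sym}^m$, viewed as the symmetric tensors. The map $\phi$ sends $f\in U_d(\mathbb{F}_p)$ to the unique $w\in V_{p-1-d}(\mathbb{F}_p)$ with $\langle w,Q\rangle_{p-1-d} = \langle f,\iota(Q)\rangle$ for all $Q\in V_{p-1-d}(\mathbb{F}_p)$. -}

module Defs where

open import Data.Nat using (ℕ; zero; suc; _+_; _*_; _∸_; _^_; NonZero)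
open import Data.Nat.DivMod using (_mod_)
open import Data.Nat.Combinatorics using (_C_)
open import Data.Fin using (Fin; toℕ; opposite) renaming (zero to fz; suc to fs)
open import Data.Integer as ℤ using (ℤ; _%ℕ_)
open import Data.Product using (_×_; Σ; ∃; _,_)
open import Data.Bool using (Bool; true; false; if_then_else_)
open import Relation.Binary.PropositionalEquality using (_≡_)
open import Relation.Nullary using (¬_)

record Mat2 : Set where
  constructor mat
  field
    a b c d : ℤ

det : Mat2 → ℤ
det (mat a b c d) = (a ℤ.* d) ℤ.- (b ℤ.* c)

NonSingular : Mat2 → Set
NonSingular M = ¬ (det M ≡ ℤ.0ℤ)

diagP1 : ℕ → Mat2
diagP1 p = mat (ℤ.+ p) (ℤ.+ 0) (ℤ.+ 0) (ℤ.+ 1)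

module Fp (p : ℕ) .{{_ : NonZero p}} where

  F : Set
  F = Fin p

  0F : F
  0F = 0 mod p

  1F : F
  1F = 1 mod p

  ofℕ : ℕ → F
  ofℕ n = n mod p

  ofℤ : ℤ → F
  ofℤ z = (z %ℕ p) mod p

  _+F_ : F → F → F
  x +F y = (toℕ x + toℕ y) mod p

  _*F_ : F → F → F
  x *F y = (toℕ x * toℕ y) mod p

  negF : F → F
  negF x = (p ∸ toℕ x) mod p

  _^F_ : F → ℕ → F
  x ^F n = (toℕ x ^ n) mod p

  -- multiplicative inverse in F_p (p prime), via Fermat: x⁻¹ = x^(p-2)
  invF : F → F
  invF x = x ^F (p ∸ 2)

  sumFin : ∀ {n} → (Fin n → F) → F
  sumFin {zero} f = 0F
  sumFin {suc n} f = f fz +F sumFin (λ i → f (fs i))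

  sumUpTo : ℕ → (ℕ → F) → F
  sumUpTo zero f = f 0
  sumUpTo (suc k) f = sumUpTo k f +F f (suc k)

  isZero : F → Bool
  isZero x with toℕ x
  ... | zero = true
  ... | suc _ = false

  -- V_n(F_p) = F_p[X,Y]_n : a polynomial is given by its coefficient
  -- vector, P i = coefficient of X^(n-i) Y^i.
  V : ℕ → Set
  V n = Fin (suc n) → F

  _≗V_ : ∀ {n} → V n → V n → Set
  P ≗V Q = ∀ i → P i ≡ Q i

  0V : ∀ {n} → V n
  0V i = 0F

  -- auxiliary homogeneous polynomials as ℕ-indexed coefficient sequences
  -- (k ↦ coefficient of X^(deg-k) Y^k), used to compute the action.
  HP : Set
  HP = ℕ → F

  mulHP : HP → HP → HP
  mulHP A B k = sumUpTo k (λ i → A i *F B (k ∸ i))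

  lin : F → F → HP
  lin α β zero = α
  lin α β (suc zero) = β
  lin α β (suc (suc _)) = 0F

  one : HP
  one zero = 1F
  one (suc _) = 0F

  powLin : F → F → ℕ → HP
  powLin α β zero = one
  powLin α β (suc n) = mulHP (lin α β) (powLin α β n)

  -- (M.P)(X,Y) = P(aX + cY, bX + dY)
  actV : ∀ {n} → Mat2 → V n → V n
  actV {n} (mat a b c d) P k =
    sumFin (λ i → P i *F mulHP (powLin (ofℤ a) (ofℤ c) (n ∸ toℕ i))
                               (powLin (ofℤ b) (ofℤ d) (toℕ i)) (toℕ k))

  scaleV : ∀ {n} → F → V n → V n
  scaleV s P i = s *F P i

  -- W(p, F_p): functions F_p^2 → F_p (vanishing at the origin is imposed
  -- as a predicate where needed)
  W : Set
  W = F → F → F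

  _≗W_ : W → W → Set
  f ≗W g = ∀ x y → f x y ≡ g x y

  VanishesAt0 : W → Set
  VanishesAt0 f = f 0F 0F ≡ 0F

  InU : ℕ → W → Set
  InU d f = VanishesAt0 f × (∀ l x y → ¬ (l ≡ 0F) → f (l *F x) (l *F y) ≡ (l ^F d) *F f x y)

  -- (M.f)(x,y) = f((x,y) M) = f(xa + yc, xb + yd)
  actW : Mat2 → W → W
  actW (mat a b c d) f x y =
    f ((x *F ofℤ a) +F (y *F ofℤ c)) ((x *F ofℤ b) +F (y *F ofℤ d))

  ι : ∀ {n} → V n → W
  ι {n} P x y =
    if isZero x then (if isZero y then 0F else val) else val
    where
    val : F
    val = sumFin (λ i → P i *F ((x ^F (n ∸ toℕ i)) *F (y ^F toℕ i)))

  pairW : W → W → F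
  pairW f g = sumFin (λ x → sumFin (λ y → f x y *F g x y))

  -- ⟨·,·⟩_m on V_m: m-th tensor power of det(v|w), restricted to
  -- symmetric tensors (X^(m-i)Y^i ↦ its symmetrisation (1/m!)Σ_σ ...).
  signF : ℕ → F
  signF zero = 1F
  signF (suc i) = negF (signF i)

  pairV : ∀ {m} → V m → V m → F
  pairV {m} P Q =
    sumFin (λ i → ((signF (toℕ i) *F invF (ofℕ (m C toℕ i))) *F P i) *F Q (opposite i))

  IsPhi : (d : ℕ) → W → V (p ∸ 1 ∸ d) → Set
  IsPhi d f w = ∀ (Q : V (p ∸ 1 ∸ d)) → pairV w Q ≡ pairW f (ι Q)

module Submission where

-- Everything rests on the power sums S k = ∑ₓ x^k over F_p, which vanish for k < p - 1 and
-- equal -1 for k = p - 1 (compare S with its translate ∑ₓ (x + 1)^k).  Hence the monomials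
-- x^a y^b and x^(p-1-a) y^(p-1-b) are dual under ⟨f, g⟩ = ∑ f g, which makes ι injective and
-- gives φ explicitly: φ(f)ᵢ = (-1)^i C(m,i) ⟨f, x^i y^(m-i)⟩ with m = p - 1 - d.  For P of
-- degree d the exponents in ⟨ι P, x^i y^(m-i)⟩ add up to p - 1, so φ ∘ ι = 0; φ is onto
-- because the dual monomials x^(d+j) y^(p-1-j) are homogeneous of degree d by Fermat.
-- Exactness in the middle: if f ∈ U_d has the same moments as ι P against all monomials of
-- degree m or 2(p-1) - d, then on the lines through the origin these moments become the
-- power moments of t ↦ (f - ι P)(1, t), and a function on F_p all of whose moments of order
-- ≤ p - 1 vanish is zero.  Equivariance of φ comes from pairing with (tX - sY)^m, the m-th
-- power of det(· | (s,t)): substituting (x,y) ↦ (x,y)M multiplies the determinant by det M,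
-- and det M^(d+m) = 1.  For M = (p 0 ; 0 1) the function M.f depends on y only, so all its
-- moments against x^i y^(m-i), i ≤ m < p - 1, vanish.

open import Defs
open import Level using (0ℓ)
open import Algebra.Bundles using (CommutativeRing)
open import Algebra.Structures using (IsCommutativeRing)
import Algebra.Properties.CommutativeSemiring.Binomial as Binomial
import Algebra.Properties.CommutativeSemiring.Exp as CommutativeSemiringExp
import Algebra.Properties.Ring as RingProperties
import Algebra.Properties.Semiring.Sum as SemiringSum
import Algebra.Solver.Ring.AlmostCommutativeRing as ACR
open import Data.Empty using (⊥-elim)
open import Data.Fin as Fin using (Fin; toℕ; fromℕ; fromℕ<; inject₁; opposite) renaming (zero to fz; suc to fs)
open import Data.Fin.Permutation using (permutation)
open import Data.Fin.Properties
  using (toℕ-injective; toℕ<n; toℕ-fromℕ; toℕ-fromℕ<; toℕ-inject₁; suc-injective; opposite-prop; opposite-involutive)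
open import Data.Integer as ℤ using (ℤ; -[1+_]; _⊖_; _%ℕ_; _/ℕ_)
open import Data.Integer.DivMod using (a≡a%ℕn+[a/ℕn]*n)
import Data.Integer.Properties as ℤ
open import Data.Maybe using (Maybe; just; nothing)
open import Data.Nat as ℕ using (ℕ; zero; suc; _∸_; _≤_; _<_; z≤n; s≤s; _!; NonZero)
  renaming (_+_ to _+ℕ_; _*_ to _*ℕ_)
open import Data.Nat.Combinatorics using (_C_; nCk≡n!/k![n-k]!; k![n∸k]!∣n!; nCn≡1; nC1≡n; nCk≡nC[n∸k])
open import Data.Nat.DivMod using (_%_; %-distribˡ-+; %-distribˡ-*; m<n⇒m%n≡m; n%n≡0; m%n<n; m/n*n≡m)
open import Data.Nat.Divisibility using (_∣_; ∣⇒≤; m∣m*n; ∣-trans; m%n≡0⇒n∣m; n∣m⇒m%n≡0)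
open import Data.Nat.Primality using (Prime; euclidsLemma; ¬prime[0]; ¬prime[1])
import Data.Nat.Properties as ℕ
open import Algebra.Properties.CommutativeSemigroup ℕ.+-commutativeSemigroup using () renaming (interchange to +-interchange)
open import Data.Product using (Σ; _×_; _,_; proj₁)
open import Data.Sum using (_⊎_; inj₁; inj₂; [_,_]′)
open import Function using (_∘_)
open import Function.Bundles using (_⇔_; mk⇔)
open import Relation.Binary using (tri<; tri≈; tri>)
open import Relation.Binary.PropositionalEquality
open import Relation.Nullary using (¬_; yes; no)

module Residues (n : ℕ) where

  -- Writing p = 2 + n makes NonZero p and p ∸ 1 ≡ suc n hold definitionally.
  p : ℕ
  p = suc (suc n)

  open Fp p public

  toℕ-ofℕ : ∀ a → toℕ (ofℕ a) ≡ a % p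
  toℕ-ofℕ a = toℕ-fromℕ< (m%n<n a p)

  ofℕ-toℕ : ∀ x → ofℕ (toℕ x) ≡ x
  ofℕ-toℕ x = toℕ-injective (trans (toℕ-ofℕ (toℕ x)) (m<n⇒m%n≡m (toℕ<n x)))

  ofℕ-hom : ∀ (_∙_ : ℕ → ℕ → ℕ) → (∀ a b → (a ∙ b) % p ≡ ((a % p) ∙ (b % p)) % p) →
            ∀ a b → ofℕ (a ∙ b) ≡ ofℕ (toℕ (ofℕ a) ∙ toℕ (ofℕ b))
  ofℕ-hom _∙_ %-distrib a b = toℕ-injective (begin
    toℕ (ofℕ (a ∙ b))                   ≡⟨ toℕ-ofℕ (a ∙ b) ⟩
    (a ∙ b) % p                         ≡⟨ %-distrib a b ⟩
    ((a % p) ∙ (b % p)) % p             ≡⟨ cong₂ (λ u v → (u ∙ v) % p) (toℕ-ofℕ a) (toℕ-ofℕ b) ⟨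
    (toℕ (ofℕ a) ∙ toℕ (ofℕ b)) % p     ≡⟨ toℕ-ofℕ (toℕ (ofℕ a) ∙ toℕ (ofℕ b)) ⟨
    toℕ (ofℕ (toℕ (ofℕ a) ∙ toℕ (ofℕ b))) ∎)
    where open ≡-Reasoning

  -- The ring operations are opaque: otherwise every equation between
  -- field elements would be normalised through ℕ-division by p.
  infixl 6 _+_
  infixl 7 _*_
  infix 8 -_
  opaque
    _+_ : F → F → F
    x + y = x +F y

    _*_ : F → F → F
    x * y = x *F y

    -_ : F → F
    - x = negF x

    ⟪_⟫ : ℕ → F
    ⟪ k ⟫ = ofℕ k

  opaque
    unfolding _+_ _*_ -_ ⟪_⟫

    +F≡+ : ∀ x y → x +F y ≡ x + y
    +F≡+ x y = refl

    *F≡* : ∀ x y → x *F y ≡ x * y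
    *F≡* x y = refl

    negF≡- : ∀ x → negF x ≡ - x
    negF≡- x = refl

    ofℕ≡⟪⟫ : ∀ k → ofℕ k ≡ ⟪ k ⟫
    ofℕ≡⟪⟫ k = refl

    ⟪+⟫ : ∀ a b → ⟪ a +ℕ b ⟫ ≡ ⟪ a ⟫ + ⟪ b ⟫
    ⟪+⟫ = ofℕ-hom _+ℕ_ (λ a b → %-distribˡ-+ a b p)

    ⟪*⟫ : ∀ a b → ⟪ a *ℕ b ⟫ ≡ ⟪ a ⟫ * ⟪ b ⟫
    ⟪*⟫ = ofℕ-hom _*ℕ_ (λ a b → %-distribˡ-* a b p)

    ⟪toℕ⟫ : ∀ x → ⟪ toℕ x ⟫ ≡ x
    ⟪toℕ⟫ = ofℕ-toℕ

    toℕ⟪⟫ : ∀ a → toℕ ⟪ a ⟫ ≡ a % p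
    toℕ⟪⟫ = toℕ-ofℕ

    ⟪0⟫ : ⟪ 0 ⟫ ≡ 0F
    ⟪0⟫ = refl

    ⟪1⟫ : ⟪ 1 ⟫ ≡ 1F
    ⟪1⟫ = refl

    ⟪p⟫ : ⟪ p ⟫ ≡ 0F
    ⟪p⟫ = toℕ-injective (trans (toℕ-ofℕ p) (n%n≡0 p))

    isCommutativeRing : IsCommutativeRing _≡_ _+_ _*_ -_ 0F 1F
    isCommutativeRing = record
      { isRing = record
        { +-isAbelianGroup = record
          { isGroup = record
            { isMonoid = record
              { isSemigroup = record
                { isMagma = record { isEquivalence = isEquivalence ; ∙-cong = cong₂ _+_ }
                ; assoc = +-assoc }
              ; identity = ofℕ-toℕ , λ x → trans (+-comm x 0F) (ofℕ-toℕ x) }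
            ; inverse = (λ x → trans (+-comm (- x) x) (-‿inverseʳ x)) , -‿inverseʳ
            ; ⁻¹-cong = cong -_ }
          ; comm = +-comm }
        ; *-cong = cong₂ _*_
        ; *-assoc = *-assoc
        ; *-identity = *-identityˡ , λ x → trans (*-comm x 1F) (*-identityˡ x)
        ; distrib = distribˡ , λ x y z → trans (*-comm (y + z) x)
                                           (trans (distribˡ x y z) (cong₂ _+_ (*-comm x y) (*-comm x z))) }
      ; *-comm = *-comm }
      where
      open ≡-Reasoning
      +-comm : ∀ x y → x + y ≡ y + x
      +-comm x y = cong ofℕ (ℕ.+-comm (toℕ x) (toℕ y))
      *-comm : ∀ x y → x * y ≡ y * x
      *-comm x y = cong ofℕ (ℕ.*-comm (toℕ x) (toℕ y))
      +-assoc : ∀ x y z → (x + y) + z ≡ x + (y + z)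
      +-assoc x y z = begin
        ofℕ (toℕ x +ℕ toℕ y) + z                   ≡⟨ cong (ofℕ (toℕ x +ℕ toℕ y) +_) (ofℕ-toℕ z) ⟨
        ofℕ (toℕ x +ℕ toℕ y) + ofℕ (toℕ z)         ≡⟨ ⟪+⟫ (toℕ x +ℕ toℕ y) (toℕ z) ⟨
        ofℕ (toℕ x +ℕ toℕ y +ℕ toℕ z)             ≡⟨ cong ofℕ (ℕ.+-assoc (toℕ x) _ _) ⟩
        ofℕ (toℕ x +ℕ (toℕ y +ℕ toℕ z))           ≡⟨ ⟪+⟫ (toℕ x) (toℕ y +ℕ toℕ z) ⟩
        ofℕ (toℕ x) + (y + z)                      ≡⟨ cong (_+ (y + z)) (ofℕ-toℕ x) ⟩
        x + (y + z)                                ∎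
      *-assoc : ∀ x y z → (x * y) * z ≡ x * (y * z)
      *-assoc x y z = begin
        ofℕ (toℕ x *ℕ toℕ y) * z                   ≡⟨ cong (ofℕ (toℕ x *ℕ toℕ y) *_) (ofℕ-toℕ z) ⟨
        ofℕ (toℕ x *ℕ toℕ y) * ofℕ (toℕ z)         ≡⟨ ⟪*⟫ (toℕ x *ℕ toℕ y) (toℕ z) ⟨
        ofℕ (toℕ x *ℕ toℕ y *ℕ toℕ z)             ≡⟨ cong ofℕ (ℕ.*-assoc (toℕ x) _ _) ⟩
        ofℕ (toℕ x *ℕ (toℕ y *ℕ toℕ z))           ≡⟨ ⟪*⟫ (toℕ x) (toℕ y *ℕ toℕ z) ⟩
        ofℕ (toℕ x) * (y * z)                      ≡⟨ cong (_* (y * z)) (ofℕ-toℕ x) ⟩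
        x * (y * z)                                ∎
      distribˡ : ∀ x y z → x * (y + z) ≡ x * y + x * z
      distribˡ x y z = begin
        x * ofℕ (toℕ y +ℕ toℕ z)                   ≡⟨ cong (_* ofℕ (toℕ y +ℕ toℕ z)) (ofℕ-toℕ x) ⟨
        ofℕ (toℕ x) * ofℕ (toℕ y +ℕ toℕ z)         ≡⟨ ⟪*⟫ (toℕ x) (toℕ y +ℕ toℕ z) ⟨
        ofℕ (toℕ x *ℕ (toℕ y +ℕ toℕ z))           ≡⟨ cong ofℕ (ℕ.*-distribˡ-+ (toℕ x) _ _) ⟩
        ofℕ (toℕ x *ℕ toℕ y +ℕ toℕ x *ℕ toℕ z)    ≡⟨ ⟪+⟫ (toℕ x *ℕ toℕ y) (toℕ x *ℕ toℕ z) ⟩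
        x * y + x * z                              ∎
      *-identityˡ : ∀ x → 1F * x ≡ x
      *-identityˡ x = trans (cong ofℕ (ℕ.+-identityʳ (toℕ x))) (ofℕ-toℕ x)
      -‿inverseʳ : ∀ x → x + - x ≡ 0F
      -‿inverseʳ x = begin
        x + - x                                    ≡⟨ cong (_+ - x) (ofℕ-toℕ x) ⟨
        ofℕ (toℕ x) + ofℕ (p ∸ toℕ x)              ≡⟨ ⟪+⟫ (toℕ x) (p ∸ toℕ x) ⟨
        ofℕ (toℕ x +ℕ (p ∸ toℕ x))                ≡⟨ cong ofℕ (ℕ.m+[n∸m]≡n (ℕ.<⇒≤ (toℕ<n x))) ⟩
        ofℕ p                                      ≡⟨ ⟪p⟫ ⟩
        0F                                         ∎

  Fp-commutativeRing : CommutativeRing 0ℓ 0ℓ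
  Fp-commutativeRing = record { isCommutativeRing = isCommutativeRing }

  open CommutativeRing Fp-commutativeRing public
    using (+-comm; +-assoc; *-comm; *-assoc; +-identityˡ; +-identityʳ; *-identityˡ; *-identityʳ;
           zeroˡ; zeroʳ; -‿inverseˡ; -‿inverseʳ; ring; semiring; commutativeSemiring)
  open RingProperties ring public using (-‿involutive; -0#≈0#; -‿+-comm; -‿distribˡ-*; -‿distribʳ-*)
  open import Algebra.Properties.Semiring.Exp semiring public using (_^_; ^-homo-*; ^-assocʳ)

  infixl 6 _-_
  _-_ : F → F → F
  x - y = x + - y

  1≢0 : ¬ 1F ≡ 0F
  1≢0 ()

  ⟪suc⟫ : ∀ a → ⟪ suc a ⟫ ≡ 1F + ⟪ a ⟫
  ⟪suc⟫ a = trans (⟪+⟫ 1 a) (cong (_+ ⟪ a ⟫) ⟪1⟫)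

  ⟪∸⟫ : ∀ a b → b ≤ a → ⟪ a ∸ b ⟫ ≡ ⟪ a ⟫ - ⟪ b ⟫
  ⟪∸⟫ a b b≤a = begin
    ⟪ a ∸ b ⟫                          ≡⟨ +-identityʳ _ ⟨
    ⟪ a ∸ b ⟫ + 0F                     ≡⟨ cong (⟪ a ∸ b ⟫ +_) (-‿inverseʳ ⟪ b ⟫) ⟨
    ⟪ a ∸ b ⟫ + (⟪ b ⟫ - ⟪ b ⟫)         ≡⟨ +-assoc _ _ _ ⟨
    (⟪ a ∸ b ⟫ + ⟪ b ⟫) - ⟪ b ⟫         ≡⟨ cong (_- ⟪ b ⟫) (⟪+⟫ (a ∸ b) b) ⟨
    ⟪ a ∸ b +ℕ b ⟫ - ⟪ b ⟫              ≡⟨ cong (λ u → ⟪ u ⟫ - ⟪ b ⟫) (ℕ.m∸n+n≡m b≤a) ⟩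
    ⟪ a ⟫ - ⟪ b ⟫                      ∎
    where open ≡-Reasoning

  ⟪⟫≡0⇒∣ : ∀ a → ⟪ a ⟫ ≡ 0F → p ∣ a
  ⟪⟫≡0⇒∣ a eq = m%n≡0⇒n∣m a p (trans (sym (toℕ⟪⟫ a)) (cong toℕ eq))

  ∣⇒⟪⟫≡0 : ∀ a → p ∣ a → ⟪ a ⟫ ≡ 0F
  ∣⇒⟪⟫≡0 a p∣a = toℕ-injective (trans (toℕ⟪⟫ a) (n∣m⇒m%n≡0 a p p∣a))

  ⟪p-1⟫ : ⟪ suc n ⟫ ≡ - 1F
  ⟪p-1⟫ = begin
    ⟪ suc n ⟫                     ≡⟨ +-identityˡ _ ⟨
    0F + ⟪ suc n ⟫                ≡⟨ cong (_+ ⟪ suc n ⟫) (-‿inverseˡ 1F) ⟨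
    (- 1F + 1F) + ⟪ suc n ⟫       ≡⟨ +-assoc _ _ _ ⟩
    - 1F + (1F + ⟪ suc n ⟫)       ≡⟨ cong (- 1F +_) (⟪suc⟫ (suc n)) ⟨
    - 1F + ⟪ p ⟫                  ≡⟨ cong (- 1F +_) ⟪p⟫ ⟩
    - 1F + 0F                     ≡⟨ +-identityʳ _ ⟩
    - 1F                          ∎
    where open ≡-Reasoning

  private
    fromℤ : ℤ → F
    fromℤ (ℤ.+ k) = ⟪ k ⟫
    fromℤ -[1+ k ] = - ⟪ suc k ⟫

    fromℤ-neg : ∀ z → fromℤ (ℤ.- z) ≡ - fromℤ z
    fromℤ-neg (ℤ.+ zero) = trans ⟪0⟫ (sym (trans (cong -_ ⟪0⟫) -0#≈0#))
    fromℤ-neg (ℤ.+ suc k) = refl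
    fromℤ-neg -[1+ k ] = sym (-‿involutive ⟪ suc k ⟫)

    fromℤ-⊖ : ∀ a b → fromℤ (a ⊖ b) ≡ ⟪ a ⟫ - ⟪ b ⟫
    fromℤ-⊖ a b with ℕ.≤-<-connex b a
    ... | inj₁ b≤a = trans (cong fromℤ (ℤ.⊖-≥ b≤a)) (⟪∸⟫ a b b≤a)
    ... | inj₂ a<b = begin
      fromℤ (a ⊖ b)                     ≡⟨ cong fromℤ (ℤ.⊖-< a<b) ⟩
      fromℤ (ℤ.- (ℤ.+ (b ∸ a)))          ≡⟨ fromℤ-neg (ℤ.+ (b ∸ a)) ⟩
      - ⟪ b ∸ a ⟫                       ≡⟨ cong -_ (⟪∸⟫ b a (ℕ.<⇒≤ a<b)) ⟩
      - (⟪ b ⟫ - ⟪ a ⟫)                 ≡⟨ -‿+-comm ⟪ b ⟫ (- ⟪ a ⟫) ⟨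
      - ⟪ b ⟫ + - - ⟪ a ⟫               ≡⟨ cong (- ⟪ b ⟫ +_) (-‿involutive ⟪ a ⟫) ⟩
      - ⟪ b ⟫ + ⟪ a ⟫                   ≡⟨ +-comm _ _ ⟩
      ⟪ a ⟫ - ⟪ b ⟫                     ∎
      where open ≡-Reasoning

    fromℤ-+ : ∀ a b → fromℤ (a ℤ.+ b) ≡ fromℤ a + fromℤ b
    fromℤ-+ (ℤ.+ a) (ℤ.+ b) = ⟪+⟫ a b
    fromℤ-+ (ℤ.+ a) -[1+ b ] = fromℤ-⊖ a (suc b)
    fromℤ-+ -[1+ a ] (ℤ.+ b) = trans (fromℤ-⊖ b (suc a)) (+-comm ⟪ b ⟫ (- ⟪ suc a ⟫))
    fromℤ-+ -[1+ a ] -[1+ b ] = begin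
      - ⟪ suc (suc (a +ℕ b)) ⟫           ≡⟨ cong (λ u → - ⟪ suc u ⟫) (ℕ.+-suc a b) ⟨
      - ⟪ suc a +ℕ suc b ⟫               ≡⟨ cong -_ (⟪+⟫ (suc a) (suc b)) ⟩
      - (⟪ suc a ⟫ + ⟪ suc b ⟫)           ≡⟨ -‿+-comm ⟪ suc a ⟫ ⟪ suc b ⟫ ⟨
      - ⟪ suc a ⟫ + - ⟪ suc b ⟫           ∎
      where open ≡-Reasoning

    fromℤ-*⁺ : ∀ a b → fromℤ (ℤ.+ a ℤ.* b) ≡ ⟪ a ⟫ * fromℤ b
    fromℤ-*⁺ a (ℤ.+ b) = trans (cong fromℤ (sym (ℤ.pos-* a b))) (⟪*⟫ a b)
    fromℤ-*⁺ a -[1+ b ] = begin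
      fromℤ (ℤ.+ a ℤ.* ℤ.- ℤ.+ suc b)      ≡⟨ cong fromℤ (ℤ.neg-distribʳ-* (ℤ.+ a) (ℤ.+ suc b)) ⟨
      fromℤ (ℤ.- (ℤ.+ a ℤ.* ℤ.+ suc b))    ≡⟨ fromℤ-neg (ℤ.+ a ℤ.* ℤ.+ suc b) ⟩
      - fromℤ (ℤ.+ a ℤ.* ℤ.+ suc b)        ≡⟨ cong -_ (fromℤ-*⁺ a (ℤ.+ suc b)) ⟩
      - (⟪ a ⟫ * ⟪ suc b ⟫)                ≡⟨ -‿distribʳ-* ⟪ a ⟫ ⟪ suc b ⟫ ⟩
      ⟪ a ⟫ * - ⟪ suc b ⟫                  ∎
      where open ≡-Reasoning

    fromℤ-* : ∀ a b → fromℤ (a ℤ.* b) ≡ fromℤ a * fromℤ b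
    fromℤ-* (ℤ.+ a) b = fromℤ-*⁺ a b
    fromℤ-* -[1+ a ] b = begin
      fromℤ (ℤ.- ℤ.+ suc a ℤ.* b)          ≡⟨ cong fromℤ (ℤ.neg-distribˡ-* (ℤ.+ suc a) b) ⟨
      fromℤ (ℤ.- (ℤ.+ suc a ℤ.* b))        ≡⟨ fromℤ-neg (ℤ.+ suc a ℤ.* b) ⟩
      - fromℤ (ℤ.+ suc a ℤ.* b)            ≡⟨ cong -_ (fromℤ-*⁺ (suc a) b) ⟩
      - (⟪ suc a ⟫ * fromℤ b)              ≡⟨ -‿distribˡ-* ⟪ suc a ⟫ (fromℤ b) ⟩
      - ⟪ suc a ⟫ * fromℤ b                ∎
      where open ≡-Reasoning

    ofℤ≗fromℤ : ∀ z → ofℤ z ≡ fromℤ z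
    ofℤ≗fromℤ z = sym (begin
      fromℤ z                                          ≡⟨ cong fromℤ (a≡a%ℕn+[a/ℕn]*n z p) ⟩
      fromℤ (ℤ.+ (z %ℕ p) ℤ.+ (z /ℕ p) ℤ.* ℤ.+ p)      ≡⟨ fromℤ-+ (ℤ.+ (z %ℕ p)) ((z /ℕ p) ℤ.* ℤ.+ p) ⟩
      ⟪ z %ℕ p ⟫ + fromℤ ((z /ℕ p) ℤ.* ℤ.+ p)          ≡⟨ cong (⟪ z %ℕ p ⟫ +_) (fromℤ-* (z /ℕ p) (ℤ.+ p)) ⟩
      ⟪ z %ℕ p ⟫ + fromℤ (z /ℕ p) * ⟪ p ⟫              ≡⟨ cong (λ u → ⟪ z %ℕ p ⟫ + fromℤ (z /ℕ p) * u) ⟪p⟫ ⟩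
      ⟪ z %ℕ p ⟫ + fromℤ (z /ℕ p) * 0F                 ≡⟨ cong (⟪ z %ℕ p ⟫ +_) (zeroʳ _) ⟩
      ⟪ z %ℕ p ⟫ + 0F                                  ≡⟨ +-identityʳ _ ⟩
      ⟪ z %ℕ p ⟫                                       ≡⟨ ofℕ≡⟪⟫ (z %ℕ p) ⟨
      ofℤ z                                            ∎)
      where open ≡-Reasoning

  ofℤ-+ : ∀ a b → ofℤ (a ℤ.+ b) ≡ ofℤ a + ofℤ b
  ofℤ-+ a b = trans (ofℤ≗fromℤ (a ℤ.+ b)) (trans (fromℤ-+ a b) (sym (cong₂ _+_ (ofℤ≗fromℤ a) (ofℤ≗fromℤ b))))

  ofℤ-* : ∀ a b → ofℤ (a ℤ.* b) ≡ ofℤ a * ofℤ b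
  ofℤ-* a b = trans (ofℤ≗fromℤ (a ℤ.* b)) (trans (fromℤ-* a b) (sym (cong₂ _*_ (ofℤ≗fromℤ a) (ofℤ≗fromℤ b))))

  ofℤ-neg : ∀ a → ofℤ (ℤ.- a) ≡ - ofℤ a
  ofℤ-neg a = trans (ofℤ≗fromℤ (ℤ.- a)) (trans (fromℤ-neg a) (sym (cong -_ (ofℤ≗fromℤ a))))

  ofℤ-+ℕ : ∀ k → ofℤ (ℤ.+ k) ≡ ⟪ k ⟫
  ofℤ-+ℕ k = trans (ofℤ≗fromℤ (ℤ.+ k)) refl

  private
    ofℤ-morphism : ℤ.+-*-rawRing ACR.-Raw-AlmostCommutative⟶ ACR.fromCommutativeRing Fp-commutativeRing
    ofℤ-morphism = record
      { ⟦_⟧ = ofℤ ; +-homo = ofℤ-+ ; *-homo = ofℤ-* ; -‿homo = ofℤ-neg ; 0-homo = refl ; 1-homo = refl }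

    ofℤ-≟ : ∀ a b → Maybe (ofℤ a ≡ ofℤ b)
    ofℤ-≟ a b with a ℤ.≟ b
    ... | yes a≡b = just (cong ofℤ a≡b)
    ... | no _ = nothing

  open import Algebra.Solver.Ring ℤ.+-*-rawRing (ACR.fromCommutativeRing Fp-commutativeRing) ofℤ-morphism ofℤ-≟ public
    using (solve; _:+_; _:*_; :-_; _:-_; con; _:=_)

  open SemiringSum semiring using (sum; sum-cong-≗; ∑-distrib-+; ∑-comm; sum-permute; sum-init-last;
                                   *-distribˡ-sum; *-distribʳ-sum)

  opaque
    ∑ : ∀ {k} → (Fin k → F) → F
    ∑ = sum

  opaque
    unfolding ∑

    ∑≡sum : ∀ {k} (f : Fin k → F) → ∑ f ≡ sum f
    ∑≡sum f = refl

    ∑-nil : (f : Fin 0 → F) → ∑ f ≡ 0F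
    ∑-nil f = refl

    ∑-suc : ∀ {k} (f : Fin (suc k) → F) → ∑ f ≡ f fz + ∑ (f ∘ fs)
    ∑-suc f = refl

    ∑-cong : ∀ {k} {f g : Fin k → F} → (∀ i → f i ≡ g i) → ∑ f ≡ ∑ g
    ∑-cong = sum-cong-≗

    ∑-+ : ∀ {k} (f g : Fin k → F) → ∑ (λ i → f i + g i) ≡ ∑ f + ∑ g
    ∑-+ = ∑-distrib-+

    ∑-swap : ∀ {k l} (f : Fin k → Fin l → F) → ∑ (λ i → ∑ (f i)) ≡ ∑ (λ j → ∑ (λ i → f i j))
    ∑-swap = ∑-comm

    ∑-init-last : ∀ {k} (f : Fin (suc k) → F) → ∑ f ≡ ∑ (f ∘ Fin.inject₁) + f (Fin.fromℕ k)
    ∑-init-last = sum-init-last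

    ∑-*ˡ : ∀ {k} c (f : Fin k → F) → ∑ (λ i → c * f i) ≡ c * ∑ f
    ∑-*ˡ c f = sym (*-distribˡ-sum c f)

    ∑-*ʳ : ∀ {k} c (f : Fin k → F) → ∑ (λ i → f i * c) ≡ ∑ f * c
    ∑-*ʳ c f = sym (*-distribʳ-sum c f)

    ∑-bijection : ∀ {k} (σ τ : Fin k → Fin k) → (∀ y → σ (τ y) ≡ y) → (∀ x → τ (σ x) ≡ x) →
                  ∀ (g : Fin k → F) → ∑ (g ∘ σ) ≡ ∑ g
    ∑-bijection σ τ στ τσ g = sym (sum-permute g (permutation σ τ στ τσ))

  ∑-zero : ∀ {k} (f : Fin k → F) → (∀ i → f i ≡ 0F) → ∑ f ≡ 0F
  ∑-zero {zero} f _ = ∑-nil f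
  ∑-zero {suc k} f f≡0 = begin
    ∑ f                    ≡⟨ ∑-suc f ⟩
    f fz + ∑ (f ∘ fs)      ≡⟨ cong₂ _+_ (f≡0 fz) (∑-zero (f ∘ fs) (f≡0 ∘ fs)) ⟩
    0F + 0F                ≡⟨ +-identityˡ 0F ⟩
    0F                     ∎
    where open ≡-Reasoning

  ∑-const : ∀ k c → ∑ {k} (λ _ → c) ≡ ⟪ k ⟫ * c
  ∑-const zero c = trans (∑-nil _) (sym (trans (cong (_* c) ⟪0⟫) (zeroˡ c)))
  ∑-const (suc k) c = begin
    ∑ {suc k} (λ _ → c)    ≡⟨ ∑-suc _ ⟩
    c + ∑ {k} (λ _ → c)    ≡⟨ cong (c +_) (∑-const k c) ⟩
    c + ⟪ k ⟫ * c          ≡⟨ solve 2 (λ c u → c :+ u :* c := (con (ℤ.+ 1) :+ u) :* c) refl c ⟪ k ⟫ ⟩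
    (1F + ⟪ k ⟫) * c       ≡⟨ cong (_* c) (⟪suc⟫ k) ⟨
    ⟪ suc k ⟫ * c          ∎
    where open ≡-Reasoning

  ∑-neg : ∀ {k} (f : Fin k → F) → ∑ (λ i → - f i) ≡ - ∑ f
  ∑-neg f = begin
    ∑ (λ i → - f i)         ≡⟨ ∑-cong (λ i → solve 1 (λ u → :- u := (:- con (ℤ.+ 1)) :* u) refl (f i)) ⟩
    ∑ (λ i → - 1F * f i)    ≡⟨ ∑-*ˡ (- 1F) f ⟩
    - 1F * ∑ f              ≡⟨ solve 1 (λ u → (:- con (ℤ.+ 1)) :* u := :- u) refl (∑ f) ⟩
    - ∑ f                   ∎
    where open ≡-Reasoning

  ∑-single : ∀ {k} (f : Fin k → F) (j : Fin k) → (∀ i → ¬ i ≡ j → f i ≡ 0F) → ∑ f ≡ f j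
  ∑-single f fz f≡0 = begin
    ∑ f                    ≡⟨ ∑-suc f ⟩
    f fz + ∑ (f ∘ fs)      ≡⟨ cong (f fz +_) (∑-zero (f ∘ fs) (λ i → f≡0 (fs i) λ ())) ⟩
    f fz + 0F              ≡⟨ +-identityʳ _ ⟩
    f fz                   ∎
    where open ≡-Reasoning
  ∑-single f (fs j) f≡0 = begin
    ∑ f                    ≡⟨ ∑-suc f ⟩
    f fz + ∑ (f ∘ fs)      ≡⟨ cong₂ _+_ (f≡0 fz λ ()) (∑-single (f ∘ fs) j (λ i i≢j → f≡0 (fs i) (i≢j ∘ suc-injective))) ⟩
    0F + f (fs j)          ≡⟨ +-identityˡ _ ⟩
    f (fs j)               ∎
    where open ≡-Reasoning

  ∑-opposite : ∀ {k} (g : Fin k → F) → ∑ (g ∘ opposite) ≡ ∑ g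
  ∑-opposite = ∑-bijection opposite opposite opposite-involutive opposite-involutive

  sumFin≡∑ : ∀ {k} (f : Fin k → F) → sumFin f ≡ ∑ f
  sumFin≡∑ {zero} f = sym (∑-nil f)
  sumFin≡∑ {suc k} f = begin
    f fz +F sumFin (f ∘ fs)  ≡⟨ +F≡+ _ _ ⟩
    f fz + sumFin (f ∘ fs)   ≡⟨ cong (f fz +_) (sumFin≡∑ (f ∘ fs)) ⟩
    f fz + ∑ (f ∘ fs)        ≡⟨ ∑-suc f ⟨
    ∑ f                      ∎
    where open ≡-Reasoning

  open CommutativeSemiringExp commutativeSemiring public using (^-distrib-*)
  open import Algebra.Properties.Semiring.Mult semiring using () renaming (_×_ to _·ₙ_)

  0^suc : ∀ k → 0F ^ suc k ≡ 0F
  0^suc k = zeroˡ (0F ^ k)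

  1^ : ∀ k → 1F ^ k ≡ 1F
  1^ zero = refl
  1^ (suc k) = trans (*-identityˡ _) (1^ k)

  -1^*-1^ : ∀ k → (- 1F) ^ k * (- 1F) ^ k ≡ 1F
  -1^*-1^ k = trans (sym (^-distrib-* (- 1F) (- 1F) k))
    (trans (cong (_^ k) (solve 0 ((:- con (ℤ.+ 1)) :* (:- con (ℤ.+ 1)) := con (ℤ.+ 1)) refl)) (1^ k))

  neg^ : ∀ x k → (- x) ^ k ≡ (- 1F) ^ k * x ^ k
  neg^ x k = trans (cong (_^ k) (solve 1 (λ x → :- x := (:- con (ℤ.+ 1)) :* x) refl x)) (^-distrib-* (- 1F) x k)

  ^F≡^ : ∀ x k → x ^F k ≡ x ^ k
  ^F≡^ x zero = refl
  ^F≡^ x (suc k) = begin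
    ofℕ (toℕ x ℕ.^ suc k)                ≡⟨ ofℕ≡⟪⟫ _ ⟩
    ⟪ toℕ x *ℕ toℕ x ℕ.^ k ⟫             ≡⟨ ⟪*⟫ (toℕ x) (toℕ x ℕ.^ k) ⟩
    ⟪ toℕ x ⟫ * ⟪ toℕ x ℕ.^ k ⟫          ≡⟨ cong₂ _*_ (⟪toℕ⟫ x) (trans (sym (ofℕ≡⟪⟫ _)) (^F≡^ x k)) ⟩
    x * x ^ k                            ∎
    where open ≡-Reasoning

  signF≡-1^ : ∀ k → signF k ≡ (- 1F) ^ k
  signF≡-1^ zero = refl
  signF≡-1^ (suc k) = begin
    negF (signF k)             ≡⟨ negF≡- (signF k) ⟩
    - signF k                  ≡⟨ cong -_ (signF≡-1^ k) ⟩
    - (- 1F) ^ k               ≡⟨ solve 1 (λ u → :- u := (:- con (ℤ.+ 1)) :* u) refl ((- 1F) ^ k) ⟩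
    - 1F * (- 1F) ^ k          ∎
    where open ≡-Reasoning

  ·ₙ≡⟪⟫* : ∀ k x → k ·ₙ x ≡ ⟪ k ⟫ * x
  ·ₙ≡⟪⟫* zero x = sym (trans (cong (_* x) ⟪0⟫) (zeroˡ x))
  ·ₙ≡⟪⟫* (suc k) x = begin
    x + k ·ₙ x                 ≡⟨ cong (x +_) (·ₙ≡⟪⟫* k x) ⟩
    x + ⟪ k ⟫ * x              ≡⟨ solve 2 (λ c u → c :+ u :* c := (con (ℤ.+ 1) :+ u) :* c) refl x ⟪ k ⟫ ⟩
    (1F + ⟪ k ⟫) * x           ≡⟨ cong (_* x) (⟪suc⟫ k) ⟨
    ⟪ suc k ⟫ * x              ∎
    where open ≡-Reasoning

  binomial : ∀ x y m → (x + y) ^ m ≡ ∑ {suc m} (λ k → ⟪ m C toℕ k ⟫ * (x ^ toℕ k * y ^ (m ∸ toℕ k)))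
  binomial x y m = begin
    (x + y) ^ m                                     ≡⟨ Binomial.theorem commutativeSemiring m x y ⟩
    Binomial.binomialExpansion commutativeSemiring x y m
                                                    ≡⟨ ∑≡sum _ ⟨
    ∑ (Binomial.binomialTerm commutativeSemiring x y m)
                                                    ≡⟨ ∑-cong (λ k → ·ₙ≡⟪⟫* (m C toℕ k) _) ⟩
    ∑ (λ k → ⟪ m C toℕ k ⟫ * (x ^ toℕ k * y ^ (m ∸ toℕ k))) ∎
    where open ≡-Reasoning

module PrimeField (n : ℕ) (isPrime : Prime (suc (suc n))) where

  open Residues n public

  x-y≡0⇒x≡y : ∀ x y → x - y ≡ 0F → x ≡ y
  x-y≡0⇒x≡y x y eq = begin
    x                ≡⟨ solve 2 (λ x y → x := (x :- y) :+ y) refl x y ⟩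
    (x - y) + y      ≡⟨ cong (_+ y) eq ⟩
    0F + y           ≡⟨ +-identityˡ y ⟩
    y                ∎
    where open ≡-Reasoning

  ¬p∣small : ∀ k → 0 < k → k < p → ¬ p ∣ k
  ¬p∣small k 0<k k<p p∣k = ℕ.<⇒≱ k<p (∣⇒≤ {{ℕ.>-nonZero 0<k}} p∣k)

  ⟪small⟫≢0 : ∀ k → 0 < k → k < p → ¬ ⟪ k ⟫ ≡ 0F
  ⟪small⟫≢0 k 0<k k<p = ¬p∣small k 0<k k<p ∘ ⟪⟫≡0⇒∣ k

  private
    p∣small⇒≡0 : ∀ k → k < p → p ∣ k → k ≡ 0
    p∣small⇒≡0 zero _ _ = refl
    p∣small⇒≡0 (suc k) k<p p∣k = ⊥-elim (¬p∣small (suc k) (s≤s z≤n) k<p p∣k)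

    p∣toℕ⇒≡0 : ∀ x → p ∣ toℕ x → x ≡ 0F
    p∣toℕ⇒≡0 x p∣x = toℕ-injective (p∣small⇒≡0 (toℕ x) (toℕ<n x) p∣x)

  x*y≡0⇒x≡0∨y≡0 : ∀ x y → x * y ≡ 0F → x ≡ 0F ⊎ y ≡ 0F
  x*y≡0⇒x≡0∨y≡0 x y xy≡0 with euclidsLemma (toℕ x) (toℕ y) isPrime (⟪⟫≡0⇒∣ _ ⟪xy⟫≡0)
    where
    ⟪xy⟫≡0 : ⟪ toℕ x *ℕ toℕ y ⟫ ≡ 0F
    ⟪xy⟫≡0 = trans (⟪*⟫ (toℕ x) (toℕ y)) (trans (cong₂ _*_ (⟪toℕ⟫ x) (⟪toℕ⟫ y)) xy≡0)
  ... | inj₁ p∣x = inj₁ (p∣toℕ⇒≡0 x p∣x)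
  ... | inj₂ p∣y = inj₂ (p∣toℕ⇒≡0 y p∣y)

  *-cancelˡ : ∀ x y z → ¬ x ≡ 0F → x * y ≡ x * z → y ≡ z
  *-cancelˡ x y z x≢0 eq = [ ⊥-elim ∘ x≢0 , x-y≡0⇒x≡y y z ]′ (x*y≡0⇒x≡0∨y≡0 x (y - z) x[y-z]≡0)
    where
    x[y-z]≡0 : x * (y - z) ≡ 0F
    x[y-z]≡0 = trans (solve 3 (λ x y z → x :* (y :- z) := x :* y :- x :* z) refl x y z)
                     (trans (cong (_- x * z) eq) (-‿inverseʳ (x * z)))

  ¬p∣k! : ∀ k → k < p → ¬ p ∣ k !
  ¬p∣k! zero _ p∣1 = ℕ.<⇒≱ (s≤s (s≤s z≤n)) (∣⇒≤ p∣1)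
  ¬p∣k! (suc k) k<p p∣k! =
    [ ¬p∣small (suc k) (s≤s z≤n) k<p , ¬p∣k! k (ℕ.<-trans (ℕ.n<1+n k) k<p) ]′ (euclidsLemma (suc k) (k !) isPrime p∣k!)

  private
    C*k!*[m∸k]!≡m! : ∀ m k → k ≤ m → (m C k) *ℕ (k ! *ℕ (m ∸ k) !) ≡ m !
    C*k!*[m∸k]!≡m! m k k≤m = trans (cong (_*ℕ (k ! *ℕ (m ∸ k) !)) (nCk≡n!/k![n-k]! k≤m))
                                   (m/n*n≡m {{_}} (k![n∸k]!∣n! k≤m))

  ⟪C⟫≢0 : ∀ m k → k ≤ m → m < p → ¬ ⟪ m C k ⟫ ≡ 0F
  ⟪C⟫≢0 m k k≤m m<p ⟪C⟫≡0 = ¬p∣k! m m<p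
    (subst (p ∣_) (C*k!*[m∸k]!≡m! m k k≤m) (∣-trans (⟪⟫≡0⇒∣ (m C k) ⟪C⟫≡0) (m∣m*n _)))

  p∣pCk : ∀ k → 0 < k → k < p → p ∣ p C k
  p∣pCk k 0<k k<p with euclidsLemma (p C k) (k ! *ℕ (p ∸ k) !) isPrime p∣C*k!*[p∸k]!
    where
    p∣C*k!*[p∸k]! : p ∣ (p C k) *ℕ (k ! *ℕ (p ∸ k) !)
    p∣C*k!*[p∸k]! = subst (p ∣_) (sym (C*k!*[m∸k]!≡m! p k (ℕ.<⇒≤ k<p))) (m∣m*n (suc n !))
  ... | inj₁ p∣C = p∣C
  ... | inj₂ p∣k!*[p∸k]! =
    ⊥-elim ([ ¬p∣k! k k<p , ¬p∣k! (p ∸ k) (ℕ.∸-monoʳ-< 0<k (ℕ.<⇒≤ k<p)) ]′ (euclidsLemma (k !) ((p ∸ k) !) isPrime p∣k!*[p∸k]!))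

  -- Frobenius: the middle binomial coefficients C(p,k), 0 < k < p, vanish in F_p.
  [x+1]^p≡x^p+1 : ∀ x → (x + 1F) ^ p ≡ x ^ p + 1F
  [x+1]^p≡x^p+1 x = begin
    (x + 1F) ^ p                                              ≡⟨ binomial x 1F p ⟩
    ∑ {suc p} T                                               ≡⟨ ∑-suc T ⟩
    T fz + ∑ (T ∘ fs)                                         ≡⟨ cong (T fz +_) (∑-init-last (T ∘ fs)) ⟩
    T fz + (∑ (T ∘ fs ∘ inject₁) + T (fs (fromℕ (suc n))))   ≡⟨ cong₂ (λ a b → T fz + (a + b)) (∑-zero _ middle≡0) last≡x^p ⟩
    T fz + (0F + x ^ p)                                       ≡⟨ cong (_+ (0F + x ^ p)) first≡1 ⟩
    1F + (0F + x ^ p)                                         ≡⟨ solve 1 (λ v → con (ℤ.+ 1) :+ (con (ℤ.+ 0) :+ v) := v :+ con (ℤ.+ 1)) refl (x ^ p) ⟩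
    x ^ p + 1F                                                ∎
    where
    open ≡-Reasoning
    T : Fin (suc p) → F
    T k = ⟪ p C toℕ k ⟫ * (x ^ toℕ k * 1F ^ (p ∸ toℕ k))
    first≡1 : T fz ≡ 1F
    first≡1 = trans (cong (_* (1F * 1F ^ p)) ⟪1⟫) (trans (*-identityˡ _) (trans (*-identityˡ _) (1^ p)))
    middle≡0 : ∀ i → T (fs (inject₁ i)) ≡ 0F
    middle≡0 i = trans (cong (_* (x ^ k * 1F ^ (p ∸ k))) (∣⇒⟪⟫≡0 _ (p∣pCk k (s≤s z≤n) k<p))) (zeroˡ _)
      where
      k = suc (toℕ (inject₁ i))
      k<p : k < p
      k<p = s≤s (subst (_< suc n) (sym (toℕ-inject₁ i)) (toℕ<n i))
    last≡x^p : T (fs (fromℕ (suc n))) ≡ x ^ p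
    last≡x^p = begin
      T (fs (fromℕ (suc n)))          ≡⟨ cong (λ j → ⟪ p C j ⟫ * (x ^ j * 1F ^ (p ∸ j))) (cong suc (toℕ-fromℕ (suc n))) ⟩
      ⟪ p C p ⟫ * (x ^ p * 1F ^ (p ∸ p)) ≡⟨ cong₂ (λ c j → ⟪ c ⟫ * (x ^ p * 1F ^ j)) (nCn≡1 p) (ℕ.n∸n≡0 p) ⟩
      ⟪ 1 ⟫ * (x ^ p * 1F)            ≡⟨ cong (_* (x ^ p * 1F)) ⟪1⟫ ⟩
      1F * (x ^ p * 1F)               ≡⟨ trans (*-identityˡ _) (*-identityʳ _) ⟩
      x ^ p                           ∎

  ⟪k⟫^p≡⟪k⟫ : ∀ k → ⟪ k ⟫ ^ p ≡ ⟪ k ⟫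
  ⟪k⟫^p≡⟪k⟫ zero = trans (cong (_^ p) ⟪0⟫) (trans (0^suc (suc n)) (sym ⟪0⟫))
  ⟪k⟫^p≡⟪k⟫ (suc k) = begin
    ⟪ suc k ⟫ ^ p         ≡⟨ cong (_^ p) (trans (⟪suc⟫ k) (+-comm 1F ⟪ k ⟫)) ⟩
    (⟪ k ⟫ + 1F) ^ p      ≡⟨ [x+1]^p≡x^p+1 ⟪ k ⟫ ⟩
    ⟪ k ⟫ ^ p + 1F        ≡⟨ cong (_+ 1F) (⟪k⟫^p≡⟪k⟫ k) ⟩
    ⟪ k ⟫ + 1F            ≡⟨ trans (+-comm ⟪ k ⟫ 1F) (sym (⟪suc⟫ k)) ⟩
    ⟪ suc k ⟫             ∎
    where open ≡-Reasoning

  x^p≡x : ∀ x → x ^ p ≡ x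
  x^p≡x x = trans (cong (_^ p) (sym (⟪toℕ⟫ x))) (trans (⟪k⟫^p≡⟪k⟫ (toℕ x)) (⟪toℕ⟫ x))

  fermat : ∀ x → ¬ x ≡ 0F → x ^ suc n ≡ 1F
  fermat x x≢0 = *-cancelˡ x _ _ x≢0 (trans (x^p≡x x) (sym (*-identityʳ x)))

  fermat-multiple : ∀ x k → ¬ x ≡ 0F → x ^ (k *ℕ suc n) ≡ 1F
  fermat-multiple x k x≢0 = begin
    x ^ (k *ℕ suc n)      ≡⟨ cong (x ^_) (ℕ.*-comm k (suc n)) ⟩
    x ^ (suc n *ℕ k)      ≡⟨ ^-assocʳ x (suc n) k ⟨
    (x ^ suc n) ^ k       ≡⟨ cong (_^ k) (fermat x x≢0) ⟩
    1F ^ k                ≡⟨ 1^ k ⟩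
    1F                    ∎
    where open ≡-Reasoning

  infix 9 _⁻¹
  _⁻¹ : F → F
  x ⁻¹ = x ^ n

  x*x⁻¹≡1 : ∀ x → ¬ x ≡ 0F → x * x ⁻¹ ≡ 1F
  x*x⁻¹≡1 = fermat

  x⁻¹*x≡1 : ∀ x → ¬ x ≡ 0F → x ⁻¹ * x ≡ 1F
  x⁻¹*x≡1 x x≢0 = trans (*-comm _ x) (fermat x x≢0)

  invF≡⁻¹ : ∀ x → invF x ≡ x ⁻¹
  invF≡⁻¹ x = ^F≡^ x n

  ∑-affine : ∀ α β → ¬ α ≡ 0F → ∀ (g : F → F) → ∑ (λ x → g (x * α + β)) ≡ ∑ g
  ∑-affine α β α≢0 = ∑-bijection (λ x → x * α + β) (λ y → (y - β) * α ⁻¹) στ τσ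
    where
    στ : ∀ y → (y - β) * α ⁻¹ * α + β ≡ y
    στ y = begin
      (y - β) * α ⁻¹ * α + β      ≡⟨ solve 4 (λ y β α i → (y :- β) :* i :* α :+ β := (y :- β) :* (α :* i) :+ β) refl y β α (α ⁻¹) ⟩
      (y - β) * (α * α ⁻¹) + β    ≡⟨ cong (λ u → (y - β) * u + β) (x*x⁻¹≡1 α α≢0) ⟩
      (y - β) * 1F + β            ≡⟨ solve 2 (λ y β → (y :- β) :* con (ℤ.+ 1) :+ β := y) refl y β ⟩
      y                           ∎
      where open ≡-Reasoning
    τσ : ∀ x → (x * α + β - β) * α ⁻¹ ≡ x
    τσ x = begin
      (x * α + β - β) * α ⁻¹      ≡⟨ solve 4 (λ x α β i → (x :* α :+ β :- β) :* i := x :* (α :* i)) refl x α β (α ⁻¹) ⟩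
      x * (α * α ⁻¹)              ≡⟨ cong (x *_) (x*x⁻¹≡1 α α≢0) ⟩
      x * 1F                      ≡⟨ *-identityʳ x ⟩
      x                           ∎
      where open ≡-Reasoning

  private
    ∑²-linear-a≢0 : ∀ a b c d → ¬ a ≡ 0F → ¬ a * d - b * c ≡ 0F → ∀ (G : F → F → F) →
                    ∑ (λ x → ∑ (λ y → G (x * a + y * c) (x * b + y * d))) ≡ ∑ (λ x → ∑ (G x))
    ∑²-linear-a≢0 a b c d a≢0 det≢0 G = begin
      ∑ (λ x → ∑ (λ y → G (x * a + y * c) (x * b + y * d)))   ≡⟨ ∑-swap _ ⟩
      ∑ (λ y → ∑ (λ x → G (x * a + y * c) (x * b + y * d)))   ≡⟨ ∑-cong (λ y → ∑-cong (λ x → cong (G _) (eliminate-x x y))) ⟩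
      ∑ (λ y → ∑ (λ x → G (x * a + y * c) ((x * a + y * c) * a ⁻¹ * b + y * δ)))
                                                              ≡⟨ ∑-cong (λ y → ∑-affine a (y * c) a≢0 (λ X → G X (X * a ⁻¹ * b + y * δ))) ⟩
      ∑ (λ y → ∑ (λ X → G X (X * a ⁻¹ * b + y * δ)))          ≡⟨ ∑-swap _ ⟩
      ∑ (λ X → ∑ (λ y → G X (X * a ⁻¹ * b + y * δ)))          ≡⟨ ∑-cong (λ X → ∑-cong (λ y → cong (G X) (+-comm _ (y * δ)))) ⟩
      ∑ (λ X → ∑ (λ y → G X (y * δ + X * a ⁻¹ * b)))          ≡⟨ ∑-cong (λ X → ∑-affine δ (X * a ⁻¹ * b) δ≢0 (G X)) ⟩
      ∑ (λ X → ∑ (G X))                                       ∎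
      where
      open ≡-Reasoning
      δ = d - c * a ⁻¹ * b
      a*a⁻¹≡1 = x*x⁻¹≡1 a a≢0
      eliminate-x : ∀ x y → x * b + y * d ≡ (x * a + y * c) * a ⁻¹ * b + y * δ
      eliminate-x x y = sym (begin
        (x * a + y * c) * a ⁻¹ * b + y * δ   ≡⟨ solve 7 (λ x y a b c d i → (x :* a :+ y :* c) :* i :* b :+ y :* (d :- c :* i :* b)
                                                                  := x :* (a :* i) :* b :+ y :* d) refl x y a b c d (a ⁻¹) ⟩
        x * (a * a ⁻¹) * b + y * d           ≡⟨ cong (λ u → x * u * b + y * d) a*a⁻¹≡1 ⟩
        x * 1F * b + y * d                   ≡⟨ cong (_+ y * d) (cong (_* b) (*-identityʳ x)) ⟩
        x * b + y * d                        ∎)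
      δ≢0 : ¬ δ ≡ 0F
      δ≢0 δ≡0 = det≢0 (begin
        a * d - b * c                        ≡⟨ solve 4 (λ a b c d → a :* d :- b :* c := a :* d :- con (ℤ.+ 1) :* c :* b) refl a b c d ⟩
        a * d - 1F * c * b                   ≡⟨ cong (λ u → a * d - u * c * b) a*a⁻¹≡1 ⟨
        a * d - a * a ⁻¹ * c * b             ≡⟨ solve 5 (λ a b c d i → a :* d :- a :* i :* c :* b := a :* (d :- c :* i :* b)) refl a b c d (a ⁻¹) ⟩
        a * δ                                ≡⟨ cong (a *_) δ≡0 ⟩
        a * 0F                               ≡⟨ zeroʳ a ⟩
        0F                                   ∎)

  ∑²-linear : ∀ a b c d → ¬ a * d - b * c ≡ 0F → ∀ (G : F → F → F) →
              ∑ (λ x → ∑ (λ y → G (x * a + y * c) (x * b + y * d))) ≡ ∑ (λ x → ∑ (G x))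
  ∑²-linear a b c d det≢0 G with a Fin.≟ 0F
  ... | no a≢0 = ∑²-linear-a≢0 a b c d a≢0 det≢0 G
  ... | yes a≡0 = begin
    ∑ (λ x → ∑ (λ y → G (x * a + y * c) (x * b + y * d)))   ≡⟨ ∑-swap _ ⟩
    ∑ (λ y → ∑ (λ x → G (x * a + y * c) (x * b + y * d)))   ≡⟨ ∑-cong (λ y → ∑-cong (λ x → cong₂ G (+-comm _ _) (+-comm _ _))) ⟩
    ∑ (λ y → ∑ (λ x → G (y * c + x * a) (y * d + x * b)))   ≡⟨ ∑²-linear-a≢0 c d a b c≢0 det′≢0 G ⟩
    ∑ (λ x → ∑ (G x))                                       ∎
    where
    open ≡-Reasoning
    det≡-bc : a * d - b * c ≡ - (b * c)
    det≡-bc = trans (cong (λ u → u * d - b * c) a≡0) (solve 3 (λ b c d → con (ℤ.+ 0) :* d :- b :* c := :- (b :* c)) refl b c d)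
    c≢0 : ¬ c ≡ 0F
    c≢0 c≡0 = det≢0 (trans det≡-bc (trans (cong (λ u → - (b * u)) c≡0) (solve 1 (λ b → :- (b :* con (ℤ.+ 0)) := con (ℤ.+ 0)) refl b)))
    det′≢0 : ¬ c * b - d * a ≡ 0F
    det′≢0 e = det≢0 (trans (solve 4 (λ a b c d → a :* d :- b :* c := :- (c :* b :- d :* a)) refl a b c d)
                            (trans (cong -_ e) -0#≈0#))

  S : ℕ → F
  S k = ∑ (λ (x : F) → x ^ k)

  S0≡0 : S 0 ≡ 0F
  S0≡0 = trans (∑-const p 1F) (trans (cong (_* 1F) ⟪p⟫) (zeroˡ 1F))

  -- Comparing S (k+1) with its translate ∑ (x + 1)^(k+1) and expanding binomially.
  ∑C*S≡0 : ∀ k → ∑ {suc k} (λ j → ⟪ suc k C toℕ j ⟫ * S (toℕ j)) ≡ 0F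
  ∑C*S≡0 k = cancel (begin
    S (suc k)                                         ≡⟨ ∑-affine 1F 1F (λ ()) (_^ suc k) ⟨
    ∑ (λ x → (x * 1F + 1F) ^ suc k)                   ≡⟨ ∑-cong (λ x → trans (cong (λ u → (u + 1F) ^ suc k) (*-identityʳ x)) (binomial x 1F (suc k))) ⟩
    ∑ (λ x → ∑ (T x))                                 ≡⟨ ∑-swap _ ⟩
    ∑ (λ j → ∑ (λ x → T x j))                         ≡⟨ ∑-cong (λ j → trans (∑-cong (λ x → term x j)) (∑-*ˡ _ _)) ⟩
    ∑ {suc (suc k)} U                                 ≡⟨ ∑-init-last U ⟩
    ∑ (U ∘ inject₁) + U (fromℕ (suc k))               ≡⟨ cong₂ _+_ (∑-cong (λ j → cong (λ u → ⟪ suc k C u ⟫ * S u) (toℕ-inject₁ j))) last ⟩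
    ∑ (λ j → ⟪ suc k C toℕ j ⟫ * S (toℕ j)) + S (suc k) ∎)
    where
    open ≡-Reasoning
    cancel : ∀ {a b} → b ≡ a + b → a ≡ 0F
    cancel {a} {b} eq = trans (solve 2 (λ a b → a := (a :+ b) :- b) refl a b) (trans (cong (_- b) (sym eq)) (-‿inverseʳ b))
    T : F → Fin (suc (suc k)) → F
    T x j = ⟪ suc k C toℕ j ⟫ * (x ^ toℕ j * 1F ^ (suc k ∸ toℕ j))
    U : Fin (suc (suc k)) → F
    U j = ⟪ suc k C toℕ j ⟫ * S (toℕ j)
    term : ∀ x j → T x j ≡ ⟪ suc k C toℕ j ⟫ * x ^ toℕ j
    term x j = cong (⟪ suc k C toℕ j ⟫ *_) (trans (cong (x ^ toℕ j *_) (1^ (suc k ∸ toℕ j))) (*-identityʳ _))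
    last : U (fromℕ (suc k)) ≡ S (suc k)
    last = begin
      U (fromℕ (suc k))                  ≡⟨ cong (λ u → ⟪ suc k C u ⟫ * S u) (toℕ-fromℕ (suc k)) ⟩
      ⟪ suc k C suc k ⟫ * S (suc k)      ≡⟨ cong (λ u → ⟪ u ⟫ * S (suc k)) (nCn≡1 (suc k)) ⟩
      ⟪ 1 ⟫ * S (suc k)                  ≡⟨ trans (cong (_* S (suc k)) ⟪1⟫) (*-identityˡ _) ⟩
      S (suc k)                          ∎

  private
    S≤≡0 : ∀ k → k < suc n → ∀ j → j ≤ k → S j ≡ 0F
    S≤≡0 zero _ .zero z≤n = S0≡0
    S≤≡0 (suc k) k<p-1 j j≤k with ℕ.m≤n⇒m<n∨m≡n j≤k
    ... | inj₁ j<k = S≤≡0 k (ℕ.<-trans (ℕ.n<1+n k) k<p-1) j (ℕ.≤-pred j<k)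
    ... | inj₂ refl = [ (λ k+2≡0 → ⊥-elim (⟪small⟫≢0 (suc (suc k)) (s≤s z≤n) (s≤s k<p-1) k+2≡0)) , (λ S≡0 → S≡0) ]′
                        (x*y≡0⇒x≡0∨y≡0 _ _ ⟪k+2⟫*S≡0)
      where
      open ≡-Reasoning
      U : Fin (suc (suc k)) → F
      U j = ⟪ suc (suc k) C toℕ j ⟫ * S (toℕ j)
      lower≡0 : ∀ i → U (inject₁ i) ≡ 0F
      lower≡0 i = trans (cong (⟪ suc (suc k) C toℕ (inject₁ i) ⟫ *_)
                          (S≤≡0 k (ℕ.<-trans (ℕ.n<1+n k) k<p-1) (toℕ (inject₁ i))
                                (subst (_≤ k) (sym (toℕ-inject₁ i)) (ℕ.≤-pred (toℕ<n i)))))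
                        (zeroʳ _)
      ⟪k+2⟫*S≡0 : ⟪ suc (suc k) ⟫ * S (suc k) ≡ 0F
      ⟪k+2⟫*S≡0 = begin
        ⟪ suc (suc k) ⟫ * S (suc k)                       ≡⟨ cong (λ u → ⟪ u ⟫ * S (suc k)) (nC1≡n (suc (suc k))) ⟨
        ⟪ suc (suc k) C 1 ⟫ * S (suc k)                   ≡⟨ cong (λ u → ⟪ u ⟫ * S (suc k)) (nCk≡nC[n∸k] (s≤s (z≤n {suc k}))) ⟩
        ⟪ suc (suc k) C suc k ⟫ * S (suc k)               ≡⟨ cong (λ u → ⟪ suc (suc k) C u ⟫ * S u) (toℕ-fromℕ (suc k)) ⟨
        U (fromℕ (suc k))                                 ≡⟨ +-identityˡ _ ⟨
        0F + U (fromℕ (suc k))                            ≡⟨ cong (_+ U (fromℕ (suc k))) (∑-zero _ lower≡0) ⟨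
        ∑ (U ∘ inject₁) + U (fromℕ (suc k))               ≡⟨ ∑-init-last U ⟨
        ∑ U                                               ≡⟨ ∑C*S≡0 (suc k) ⟩
        0F                                                ∎

  S≡0 : ∀ k → k < suc n → S k ≡ 0F
  S≡0 k k<p-1 = S≤≡0 k k<p-1 k ℕ.≤-refl

  S[p-1]≡-1 : S (suc n) ≡ - 1F
  S[p-1]≡-1 = begin
    S (suc n)                              ≡⟨ ∑-suc _ ⟩
    0F ^ suc n + ∑ (λ i → fs i ^ suc n)    ≡⟨ cong₂ _+_ (0^suc n) (∑-cong (λ i → fermat (fs i) λ ())) ⟩
    0F + ∑ {suc n} (λ _ → 1F)              ≡⟨ +-identityˡ _ ⟩
    ∑ {suc n} (λ _ → 1F)                   ≡⟨ ∑-const (suc n) 1F ⟩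
    ⟪ suc n ⟫ * 1F                         ≡⟨ trans (*-identityʳ _) ⟪p-1⟫ ⟩
    - 1F                                   ∎
    where open ≡-Reasoning

  private
    exponent<p-1 : ∀ {e k l} → e +ℕ l ≡ suc n +ℕ k → k < l → e < suc n
    exponent<p-1 {e} {k} {l} eq k<l = ℕ.+-cancelʳ-< l e (suc n) (subst (_< suc n +ℕ l) (sym eq) (ℕ.+-monoʳ-< (suc n) k<l))

  S*S≡0-offDiagonal : ∀ a b i j → a +ℕ i ≡ suc n +ℕ j → b +ℕ j ≡ suc n +ℕ i → ¬ i ≡ j → S a * S b ≡ 0F
  S*S≡0-offDiagonal a b i j a+i≡ b+j≡ i≢j with ℕ.<-cmp i j
  ... | tri≈ _ i≡j _ = ⊥-elim (i≢j i≡j)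
  ... | tri< i<j _ _ = trans (cong (S a *_) (S≡0 b (exponent<p-1 b+j≡ i<j))) (zeroʳ _)
  ... | tri> _ _ j<i = trans (cong (_* S b) (S≡0 a (exponent<p-1 a+i≡ j<i))) (zeroˡ _)

  S*S≡1-diagonal : ∀ a b i → a +ℕ i ≡ suc n +ℕ i → b +ℕ i ≡ suc n +ℕ i → S a * S b ≡ 1F
  S*S≡1-diagonal a b i a+i≡ b+i≡ = begin
    S a * S b                 ≡⟨ cong₂ (λ u v → S u * S v) (ℕ.+-cancelʳ-≡ i a (suc n) a+i≡) (ℕ.+-cancelʳ-≡ i b (suc n) b+i≡) ⟩
    S (suc n) * S (suc n)     ≡⟨ cong₂ _*_ S[p-1]≡-1 S[p-1]≡-1 ⟩
    - 1F * - 1F               ≡⟨ solve 0 ((:- con (ℤ.+ 1)) :* (:- con (ℤ.+ 1)) := con (ℤ.+ 1)) refl ⟩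
    1F                        ∎
    where open ≡-Reasoning

  -- 1 - (t - t₀)^(p-1) is the indicator of t₀; expanding it binomially writes α t₀ through the moments.
  moments≡0⇒≡0 : ∀ (α : F → F) → (∀ b → b ≤ suc n → ∑ (λ t → α t * t ^ b) ≡ 0F) → ∀ t₀ → α t₀ ≡ 0F
  moments≡0⇒≡0 α moments≡0 t₀ = begin
    α t₀                                            ≡⟨ solve 1 (λ a → a := a :* (con (ℤ.+ 1) :- con (ℤ.+ 0))) refl (α t₀) ⟩
    α t₀ * (1F - 0F)                                ≡⟨ cong (λ u → α t₀ * (1F - u)) (trans (cong (_^ suc n) (-‿inverseʳ t₀)) (0^suc n)) ⟨
    α t₀ * (1F - (t₀ - t₀) ^ suc n)                 ≡⟨ ∑-single (λ t → α t * (1F - (t - t₀) ^ suc n)) t₀ off-t₀ ⟨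
    ∑ (λ t → α t * (1F - (t - t₀) ^ suc n))         ≡⟨ ∑-cong (λ t → solve 2 (λ a v → a :* (con (ℤ.+ 1) :- v) := a :* con (ℤ.+ 1) :+ :- (a :* v)) refl (α t) ((t - t₀) ^ suc n)) ⟩
    ∑ (λ t → α t * t ^ 0 + - (α t * (t - t₀) ^ suc n)) ≡⟨ ∑-+ _ _ ⟩
    ∑ (λ t → α t * t ^ 0) + ∑ (λ t → - (α t * (t - t₀) ^ suc n))
                                                    ≡⟨ cong₂ _+_ (moments≡0 0 z≤n) (∑-neg _) ⟩
    0F + - ∑ (λ t → α t * (t - t₀) ^ suc n)         ≡⟨ cong (λ u → 0F + - u) expansion ⟩
    0F + - 0F                                       ≡⟨ -‿inverseʳ 0F ⟩
    0F                                              ∎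
    where
    open ≡-Reasoning
    off-t₀ : ∀ t → ¬ t ≡ t₀ → α t * (1F - (t - t₀) ^ suc n) ≡ 0F
    off-t₀ t t≢t₀ = trans (cong (λ u → α t * (1F - u)) (fermat (t - t₀) (t≢t₀ ∘ x-y≡0⇒x≡y t t₀)))
                          (trans (cong (α t *_) (-‿inverseʳ 1F)) (zeroʳ _))
    coefficient : Fin (suc (suc n)) → F
    coefficient k = ⟪ suc n C toℕ k ⟫ * (- t₀) ^ (suc n ∸ toℕ k)
    expansion : ∑ (λ t → α t * (t - t₀) ^ suc n) ≡ 0F
    expansion = begin
      ∑ (λ t → α t * (t - t₀) ^ suc n)
        ≡⟨ ∑-cong (λ t → trans (cong (α t *_) (binomial t (- t₀) (suc n))) (trans (sym (∑-*ˡ (α t) _))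
             (∑-cong (λ k → solve 4 (λ a c x y → a :* (c :* (x :* y)) := (c :* y) :* (a :* x)) refl
                                     (α t) ⟪ suc n C toℕ k ⟫ (t ^ toℕ k) ((- t₀) ^ (suc n ∸ toℕ k)))))) ⟩
      ∑ (λ t → ∑ (λ k → coefficient k * (α t * t ^ toℕ k)))   ≡⟨ ∑-swap _ ⟩
      ∑ (λ k → ∑ (λ t → coefficient k * (α t * t ^ toℕ k)))   ≡⟨ ∑-cong (λ k → ∑-*ˡ (coefficient k) _) ⟩
      ∑ (λ k → coefficient k * ∑ (λ t → α t * t ^ toℕ k))     ≡⟨ ∑-zero _ (λ k → trans (cong (coefficient k *_) (moments≡0 (toℕ k) (ℕ.≤-pred (toℕ<n k)))) (zeroʳ _)) ⟩
      0F                                                      ∎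

module Forms (n : ℕ) (isPrime : Prime (suc (suc n))) where

  open PrimeField n isPrime public

  ev : ∀ {k} → V k → F → F → F
  ev {k} P x y = ∑ (λ i → P i * (x ^ (k ∸ toℕ i) * y ^ toℕ i))

  NonOrigin : F → F → Set
  NonOrigin x y = ¬ (x ≡ 0F × y ≡ 0F)

  private
    sumFin≡ev : ∀ {k} (P : V k) x y → sumFin (λ i → P i *F ((x ^F (k ∸ toℕ i)) *F (y ^F toℕ i))) ≡ ev P x y
    sumFin≡ev {k} P x y = trans (sumFin≡∑ _) (∑-cong (λ i →
      trans (*F≡* (P i) _) (cong (P i *_) (trans (*F≡* _ _) (cong₂ _*_ (^F≡^ x (k ∸ toℕ i)) (^F≡^ y (toℕ i)))))))

  ι-ev : ∀ {k} (P : V k) x y → NonOrigin x y → ι P x y ≡ ev P x y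
  ι-ev P fz fz x,y≢0 = ⊥-elim (x,y≢0 (refl , refl))
  ι-ev P fz (fs y) _ = sumFin≡ev P fz (fs y)
  ι-ev P (fs x) y _ = sumFin≡ev P (fs x) y

  ev≗⇒ι≗ : ∀ {k} (P Q : V k) → (∀ x y → ev P x y ≡ ev Q x y) → ι P ≗W ι Q
  ev≗⇒ι≗ P Q eq fz fz = refl
  ev≗⇒ι≗ P Q eq fz (fs y) = trans (ι-ev P fz (fs y) (λ ())) (trans (eq fz (fs y)) (sym (ι-ev Q fz (fs y) (λ ()))))
  ev≗⇒ι≗ P Q eq (fs x) y = trans (ι-ev P (fs x) y (λ ())) (trans (eq (fs x) y) (sym (ι-ev Q (fs x) y (λ ()))))

  0^a*0^b≡0 : ∀ a b → 0 < a +ℕ b → 0F ^ a * 0F ^ b ≡ 0F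
  0^a*0^b≡0 zero (suc b) _ = trans (*-identityˡ _) (0^suc b)
  0^a*0^b≡0 (suc a) b _ = trans (cong (_* 0F ^ b) (0^suc a)) (zeroˡ _)

  ev-origin : ∀ {k} (P : V k) → 0 < k → ev P 0F 0F ≡ 0F
  ev-origin {k} P 0<k = ∑-zero _ (λ i → trans (cong (P i *_) (0^a*0^b≡0 (k ∸ toℕ i) (toℕ i)
    (subst (0 <_) (sym (ℕ.m∸n+n≡m (ℕ.≤-pred (toℕ<n i)))) 0<k))) (zeroʳ _))

  ι≡ev-unless-origin : ∀ {k} (P : V k) X Y → (X ≡ 0F → Y ≡ 0F → ev P X Y ≡ 0F) → ι P X Y ≡ ev P X Y
  ι≡ev-unless-origin P fz fz ev≡0 = sym (ev≡0 refl refl)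
  ι≡ev-unless-origin P fz (fs Y) _ = ι-ev P fz (fs Y) (λ ())
  ι≡ev-unless-origin P (fs X) Y _ = ι-ev P (fs X) Y (λ ())

  ι≡ev : ∀ {k} (P : V k) → 0 < k → ∀ x y → ι P x y ≡ ev P x y
  ι≡ev P 0<k x y = ι≡ev-unless-origin P x y (λ x≡0 y≡0 → trans (cong₂ (ev P) x≡0 y≡0) (ev-origin P 0<k))

  ev-homogeneous : ∀ {k} (P : V k) l x y → ev P (l * x) (l * y) ≡ l ^ k * ev P x y
  ev-homogeneous {k} P l x y = trans (∑-cong term) (∑-*ˡ (l ^ k) _)
    where
    term : ∀ i → P i * ((l * x) ^ (k ∸ toℕ i) * (l * y) ^ toℕ i) ≡ l ^ k * (P i * (x ^ (k ∸ toℕ i) * y ^ toℕ i))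
    term i = begin
      P i * ((l * x) ^ (k ∸ toℕ i) * (l * y) ^ toℕ i)
        ≡⟨ cong₂ (λ u v → P i * (u * v)) (^-distrib-* l x (k ∸ toℕ i)) (^-distrib-* l y (toℕ i)) ⟩
      P i * ((l ^ (k ∸ toℕ i) * x ^ (k ∸ toℕ i)) * (l ^ toℕ i * y ^ toℕ i))
        ≡⟨ solve 5 (λ P a b c e → P :* ((a :* b) :* (c :* e)) := (a :* c) :* (P :* (b :* e))) refl
                   (P i) (l ^ (k ∸ toℕ i)) (x ^ (k ∸ toℕ i)) (l ^ toℕ i) (y ^ toℕ i) ⟩
      (l ^ (k ∸ toℕ i) * l ^ toℕ i) * (P i * (x ^ (k ∸ toℕ i) * y ^ toℕ i))
        ≡⟨ cong (_* _) (trans (sym (^-homo-* l (k ∸ toℕ i) (toℕ i))) (cong (l ^_) (ℕ.m∸n+n≡m (ℕ.≤-pred (toℕ<n i))))) ⟩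
      l ^ k * (P i * (x ^ (k ∸ toℕ i) * y ^ toℕ i)) ∎
      where open ≡-Reasoning

  scale-NonOrigin : ∀ l x y → ¬ l ≡ 0F → NonOrigin x y → NonOrigin (l * x) (l * y)
  scale-NonOrigin l x y l≢0 x,y≢0 (lx≡0 , ly≡0) =
    x,y≢0 ([ ⊥-elim ∘ l≢0 , (λ x≡0 → x≡0) ]′ (x*y≡0⇒x≡0∨y≡0 l x lx≡0) ,
           [ ⊥-elim ∘ l≢0 , (λ y≡0 → y≡0) ]′ (x*y≡0⇒x≡0∨y≡0 l y ly≡0))

  private
    ι-homogeneous-off-origin : ∀ {k} (P : V k) l x y → ¬ l ≡ 0F → NonOrigin x y →
                               ι P (l * x) (l * y) ≡ l ^ k * ι P x y
    ι-homogeneous-off-origin {k} P l x y l≢0 x,y≢0 =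
      trans (ι-ev P _ _ (scale-NonOrigin l x y l≢0 x,y≢0))
            (trans (ev-homogeneous P l x y) (cong (l ^ k *_) (sym (ι-ev P x y x,y≢0))))

  ι-homogeneous : ∀ {k} (P : V k) l x y → ¬ l ≡ 0F → ι P (l * x) (l * y) ≡ l ^ k * ι P x y
  ι-homogeneous P l fz fz l≢0 = trans (cong₂ (ι P) (zeroʳ l) (zeroʳ l)) (sym (zeroʳ _))
  ι-homogeneous P l fz (fs y) l≢0 = ι-homogeneous-off-origin P l fz (fs y) l≢0 (λ ())
  ι-homogeneous P l (fs x) y l≢0 = ι-homogeneous-off-origin P l (fs x) y l≢0 (λ ())

  pair : W → W → F
  pair f g = ∑ (λ x → ∑ (λ y → f x y * g x y))

  pairW≡pair : ∀ f g → pairW f g ≡ pair f g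
  pairW≡pair f g = trans (sumFin≡∑ _) (∑-cong (λ x → trans (sumFin≡∑ _) (∑-cong (λ y → *F≡* (f x y) (g x y)))))

  pair-cong : ∀ {f f′ g g′} → f ≗W f′ → g ≗W g′ → pair f g ≡ pair f′ g′
  pair-cong f≗f′ g≗g′ = ∑-cong (λ x → ∑-cong (λ y → cong₂ _*_ (f≗f′ x y) (g≗g′ x y)))

  pair-comm : ∀ f g → pair f g ≡ pair g f
  pair-comm f g = ∑-cong (λ x → ∑-cong (λ y → *-comm (f x y) (g x y)))

  pair-ι : ∀ {k} f (Q : V k) → VanishesAt0 f → pair f (ι Q) ≡ pair f (ev Q)
  pair-ι f Q f00≡0 = ∑-cong (λ x → ∑-cong (λ y → pointwise x y))
    where
    pointwise : ∀ x y → f x y * ι Q x y ≡ f x y * ev Q x y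
    pointwise fz fz = trans (cong (_* 0F) f00≡0) (trans (zeroˡ 0F) (sym (trans (cong (_* ev Q fz fz) f00≡0) (zeroˡ _))))
    pointwise fz (fs y) = cong (f fz (fs y) *_) (ι-ev Q fz (fs y) (λ ()))
    pointwise (fs x) y = cong (f (fs x) y *_) (ι-ev Q (fs x) y (λ ()))

  monomial : ℕ → ℕ → W
  monomial a b x y = x ^ a * y ^ b

  moment : W → ℕ → ℕ → F
  moment f a b = pair f (monomial a b)

  pair-ev : ∀ {k} f (Q : V k) → pair f (ev Q) ≡ ∑ (λ i → Q i * moment f (k ∸ toℕ i) (toℕ i))
  pair-ev {k} f Q = begin
    ∑ (λ x → ∑ (λ y → f x y * ∑ (λ i → Q i * m i x y)))        ≡⟨ ∑-cong (λ x → ∑-cong (λ y → sym (∑-*ˡ (f x y) _))) ⟩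
    ∑ (λ x → ∑ (λ y → ∑ (λ i → f x y * (Q i * m i x y))))      ≡⟨ ∑-cong (λ x → ∑-cong (λ y → ∑-cong (λ i → rearrange x y i))) ⟩
    ∑ (λ x → ∑ (λ y → ∑ (λ i → Q i * (f x y * m i x y))))      ≡⟨ ∑-cong (λ x → ∑-swap _) ⟩
    ∑ (λ x → ∑ (λ i → ∑ (λ y → Q i * (f x y * m i x y))))      ≡⟨ ∑-swap _ ⟩
    ∑ (λ i → ∑ (λ x → ∑ (λ y → Q i * (f x y * m i x y))))      ≡⟨ ∑-cong (λ i → trans (∑-cong (λ x → ∑-*ˡ (Q i) _)) (∑-*ˡ (Q i) _)) ⟩
    ∑ (λ i → Q i * moment f (k ∸ toℕ i) (toℕ i))               ∎
    where
    open ≡-Reasoning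
    m : Fin (suc k) → W
    m i = monomial (k ∸ toℕ i) (toℕ i)
    rearrange : ∀ x y i → f x y * (Q i * m i x y) ≡ Q i * (f x y * m i x y)
    rearrange x y i = solve 3 (λ a b c → a :* (b :* c) := b :* (a :* c)) refl (f x y) (Q i) (m i x y)

  moment-monomial : ∀ a b c d → moment (monomial a b) c d ≡ S (a +ℕ c) * S (b +ℕ d)
  moment-monomial a b c d = begin
    ∑ (λ x → ∑ (λ y → (x ^ a * y ^ b) * (x ^ c * y ^ d)))      ≡⟨ ∑-cong (λ x → ∑-cong (λ y → regroup x y)) ⟩
    ∑ (λ x → ∑ (λ y → x ^ (a +ℕ c) * y ^ (b +ℕ d)))            ≡⟨ ∑-cong (λ x → ∑-*ˡ _ _) ⟩
    ∑ (λ x → x ^ (a +ℕ c) * S (b +ℕ d))                        ≡⟨ ∑-*ʳ _ _ ⟩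
    S (a +ℕ c) * S (b +ℕ d)                                    ∎
    where
    open ≡-Reasoning
    regroup : ∀ x y → (x ^ a * y ^ b) * (x ^ c * y ^ d) ≡ x ^ (a +ℕ c) * y ^ (b +ℕ d)
    regroup x y = trans (solve 4 (λ p q r s → (p :* q) :* (r :* s) := (p :* r) :* (q :* s)) refl (x ^ a) (y ^ b) (x ^ c) (y ^ d))
                        (sym (cong₂ _*_ (^-homo-* x a c) (^-homo-* y b d)))

  -- Pairing with x^(p-1-k+j) y^(p-1-j) reads off the j-th coefficient of a form of degree k ≤ p - 1.
  coefficientProbe : ℕ → ℕ → W
  coefficientProbe k j = monomial ((suc n ∸ k) +ℕ j) (suc n ∸ j)

  coefficientProbe-origin : ∀ k j → j ≤ suc n → VanishesAt0 (coefficientProbe k j)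
  coefficientProbe-origin k j j≤p-1 = 0^a*0^b≡0 ((suc n ∸ k) +ℕ j) (suc n ∸ j)
    (ℕ.<-≤-trans (s≤s z≤n) (ℕ.≤-trans (ℕ.≤-reflexive (sym (ℕ.m+[n∸m]≡n j≤p-1)))
                                      (ℕ.+-monoˡ-≤ (suc n ∸ j) (ℕ.m≤n+m j (suc n ∸ k)))))

  private
    probe-exponent₁ : ∀ k i j → k ≤ suc n → i ≤ k → (suc n ∸ k) +ℕ j +ℕ (k ∸ i) +ℕ i ≡ suc n +ℕ j
    probe-exponent₁ k i j k≤p-1 i≤k = begin
      (suc n ∸ k) +ℕ j +ℕ (k ∸ i) +ℕ i     ≡⟨ ℕ.+-assoc ((suc n ∸ k) +ℕ j) (k ∸ i) i ⟩
      (suc n ∸ k) +ℕ j +ℕ ((k ∸ i) +ℕ i)   ≡⟨ cong ((suc n ∸ k) +ℕ j +ℕ_) (ℕ.m∸n+n≡m i≤k) ⟩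
      (suc n ∸ k) +ℕ j +ℕ k                ≡⟨ ℕ.+-assoc (suc n ∸ k) j k ⟩
      (suc n ∸ k) +ℕ (j +ℕ k)              ≡⟨ cong ((suc n ∸ k) +ℕ_) (ℕ.+-comm j k) ⟩
      (suc n ∸ k) +ℕ (k +ℕ j)              ≡⟨ ℕ.+-assoc (suc n ∸ k) k j ⟨
      (suc n ∸ k) +ℕ k +ℕ j                ≡⟨ cong (_+ℕ j) (ℕ.m∸n+n≡m k≤p-1) ⟩
      suc n +ℕ j                           ∎
      where open ≡-Reasoning

    probe-exponent₂ : ∀ i j → j ≤ suc n → (suc n ∸ j) +ℕ i +ℕ j ≡ suc n +ℕ i
    probe-exponent₂ i j j≤p-1 = begin
      (suc n ∸ j) +ℕ i +ℕ j                ≡⟨ ℕ.+-assoc (suc n ∸ j) i j ⟩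
      (suc n ∸ j) +ℕ (i +ℕ j)              ≡⟨ cong ((suc n ∸ j) +ℕ_) (ℕ.+-comm i j) ⟩
      (suc n ∸ j) +ℕ (j +ℕ i)              ≡⟨ ℕ.+-assoc (suc n ∸ j) j i ⟨
      (suc n ∸ j) +ℕ j +ℕ i                ≡⟨ cong (_+ℕ i) (ℕ.m∸n+n≡m j≤p-1) ⟩
      suc n +ℕ i                           ∎
      where open ≡-Reasoning

  moment-coefficientProbe-≢ : ∀ k (i j : Fin (suc k)) → k ≤ suc n → ¬ i ≡ j →
                              moment (coefficientProbe k (toℕ j)) (k ∸ toℕ i) (toℕ i) ≡ 0F
  moment-coefficientProbe-≢ k i j k≤p-1 i≢j =
    trans (moment-monomial ((suc n ∸ k) +ℕ toℕ j) (suc n ∸ toℕ j) (k ∸ toℕ i) (toℕ i))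
          (S*S≡0-offDiagonal ((suc n ∸ k) +ℕ toℕ j +ℕ (k ∸ toℕ i)) ((suc n ∸ toℕ j) +ℕ toℕ i) (toℕ i) (toℕ j) (probe-exponent₁ k (toℕ i) (toℕ j) k≤p-1 (ℕ.≤-pred (toℕ<n i)))
                                              (probe-exponent₂ (toℕ i) (toℕ j) (ℕ.≤-trans (ℕ.≤-pred (toℕ<n j)) k≤p-1))
                                              (i≢j ∘ toℕ-injective))

  moment-coefficientProbe-≡ : ∀ k (j : Fin (suc k)) → k ≤ suc n →
                              moment (coefficientProbe k (toℕ j)) (k ∸ toℕ j) (toℕ j) ≡ 1F
  moment-coefficientProbe-≡ k j k≤p-1 =
    trans (moment-monomial ((suc n ∸ k) +ℕ toℕ j) (suc n ∸ toℕ j) (k ∸ toℕ j) (toℕ j))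
          (S*S≡1-diagonal ((suc n ∸ k) +ℕ toℕ j +ℕ (k ∸ toℕ j)) ((suc n ∸ toℕ j) +ℕ toℕ j) (toℕ j) (probe-exponent₁ k (toℕ j) (toℕ j) k≤p-1 (ℕ.≤-pred (toℕ<n j)))
                                    (probe-exponent₂ (toℕ j) (toℕ j) (ℕ.≤-trans (ℕ.≤-pred (toℕ<n j)) k≤p-1)))

  pair-coefficientProbe-ev : ∀ {k} (Q : V k) → k ≤ suc n → ∀ j → pair (coefficientProbe k (toℕ j)) (ev Q) ≡ Q j
  pair-coefficientProbe-ev {k} Q k≤p-1 j = begin
    pair (coefficientProbe k (toℕ j)) (ev Q)                            ≡⟨ pair-ev _ Q ⟩
    ∑ (λ i → Q i * moment (coefficientProbe k (toℕ j)) (k ∸ toℕ i) (toℕ i))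
                                                                       ≡⟨ ∑-single _ j (λ i i≢j → trans (cong (Q i *_)
                                                                            (moment-coefficientProbe-≢ k i j k≤p-1 i≢j)) (zeroʳ _)) ⟩
    Q j * moment (coefficientProbe k (toℕ j)) (k ∸ toℕ j) (toℕ j)      ≡⟨ cong (Q j *_) (moment-coefficientProbe-≡ k j k≤p-1) ⟩
    Q j * 1F                                                           ≡⟨ *-identityʳ _ ⟩
    Q j                                                                ∎
    where open ≡-Reasoning

  pair-coefficientProbe-ι : ∀ {k} (Q : V k) → k ≤ suc n → ∀ j → pair (coefficientProbe k (toℕ j)) (ι Q) ≡ Q j
  pair-coefficientProbe-ι {k} Q k≤p-1 j =
    trans (pair-ι _ Q (coefficientProbe-origin k (toℕ j) (ℕ.≤-trans (ℕ.≤-pred (toℕ<n j)) k≤p-1)))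
          (pair-coefficientProbe-ev Q k≤p-1 j)

  ι-injective : ∀ {k} (P Q : V k) → k ≤ suc n → ι P ≗W ι Q → P ≗V Q
  ι-injective {k} P Q k≤p-1 ιP≗ιQ j = begin
    P j                                         ≡⟨ pair-coefficientProbe-ι P k≤p-1 j ⟨
    pair (coefficientProbe k (toℕ j)) (ι P)     ≡⟨ pair-cong (λ _ _ → refl) ιP≗ιQ ⟩
    pair (coefficientProbe k (toℕ j)) (ι Q)     ≡⟨ pair-coefficientProbe-ι Q k≤p-1 j ⟩
    Q j                                         ∎
    where open ≡-Reasoning

  opaque
    ∑< : ℕ → (ℕ → F) → F
    ∑< N g = ∑ {N} (g ∘ toℕ)

  opaque
    unfolding ∑<

    ∑<≡∑ : ∀ N g → ∑< N g ≡ ∑ {N} (g ∘ toℕ)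
    ∑<≡∑ N g = refl

    ∑<-nil : ∀ g → ∑< 0 g ≡ 0F
    ∑<-nil g = ∑-nil _

    ∑<-suc : ∀ N g → ∑< (suc N) g ≡ g 0 + ∑< N (g ∘ suc)
    ∑<-suc N g = ∑-suc (g ∘ toℕ)

    ∑<-last : ∀ N g → ∑< (suc N) g ≡ ∑< N g + g N
    ∑<-last N g = trans (∑-init-last _) (cong₂ _+_ (∑-cong (cong g ∘ toℕ-inject₁)) (cong g (toℕ-fromℕ N)))

    ∑<-cong : ∀ N {f g : ℕ → F} → (∀ i → i < N → f i ≡ g i) → ∑< N f ≡ ∑< N g
    ∑<-cong N f≗g = ∑-cong (λ i → f≗g (toℕ i) (toℕ<n i))

    ∑<-zero : ∀ N (g : ℕ → F) → (∀ i → i < N → g i ≡ 0F) → ∑< N g ≡ 0F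
    ∑<-zero N g g≡0 = ∑-zero _ (λ i → g≡0 (toℕ i) (toℕ<n i))

    ∑<-+ : ∀ N (f g : ℕ → F) → ∑< N (λ i → f i + g i) ≡ ∑< N f + ∑< N g
    ∑<-+ N f g = ∑-+ _ _

    ∑<-*ˡ : ∀ N c (g : ℕ → F) → ∑< N (λ i → c * g i) ≡ c * ∑< N g
    ∑<-*ˡ N c g = ∑-*ˡ c _

    ∑<-*ʳ : ∀ N c (g : ℕ → F) → ∑< N (λ i → g i * c) ≡ ∑< N g * c
    ∑<-*ʳ N c g = ∑-*ʳ c _

  ∑<-one : ∀ g → ∑< 1 g ≡ g 0
  ∑<-one g = trans (∑<-suc 0 g) (trans (cong (g 0 +_) (∑<-nil _)) (+-identityʳ _))

  ∑<-split : ∀ a b g → ∑< (a +ℕ b) g ≡ ∑< a g + ∑< b (λ j → g (a +ℕ j))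
  ∑<-split zero b g = sym (trans (cong (_+ ∑< b g) (∑<-nil g)) (+-identityˡ _))
  ∑<-split (suc a) b g = begin
    ∑< (suc (a +ℕ b)) g                                   ≡⟨ ∑<-suc (a +ℕ b) g ⟩
    g 0 + ∑< (a +ℕ b) (g ∘ suc)                           ≡⟨ cong (g 0 +_) (∑<-split a b (g ∘ suc)) ⟩
    g 0 + (∑< a (g ∘ suc) + ∑< b (λ j → g (suc a +ℕ j)))  ≡⟨ +-assoc _ _ _ ⟨
    (g 0 + ∑< a (g ∘ suc)) + ∑< b (λ j → g (suc a +ℕ j))  ≡⟨ cong (_+ ∑< b (λ j → g (suc a +ℕ j))) (∑<-suc a g) ⟨
    ∑< (suc a) g + ∑< b (λ j → g (suc a +ℕ j))            ∎
    where open ≡-Reasoning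

  ∑<-triangle : ∀ N (G : ℕ → ℕ → F) →
                ∑< (suc N) (λ k → ∑< (suc k) (λ i → G i k)) ≡ ∑< (suc N) (λ i → ∑< (suc (N ∸ i)) (λ j → G i (i +ℕ j)))
  ∑<-triangle zero G = trans (∑<-one _) (trans (∑<-one _) (sym (trans (∑<-one _) (∑<-one _))))
  ∑<-triangle (suc N) G = begin
    ∑< (suc (suc N)) (λ k → ∑< (suc k) (λ i → G i k))
      ≡⟨ ∑<-last (suc N) _ ⟩
    ∑< (suc N) (λ k → ∑< (suc k) (λ i → G i k)) + ∑< (suc (suc N)) (λ i → G i (suc N))
      ≡⟨ cong₂ _+_ (∑<-triangle N G) (∑<-last (suc N) _) ⟩
    ∑< (suc N) (λ i → ∑< (suc (N ∸ i)) (λ j → G i (i +ℕ j))) + (∑< (suc N) (λ i → G i (suc N)) + G (suc N) (suc N))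
      ≡⟨ +-assoc _ _ _ ⟨
    (∑< (suc N) (λ i → ∑< (suc (N ∸ i)) (λ j → G i (i +ℕ j))) + ∑< (suc N) (λ i → G i (suc N))) + G (suc N) (suc N)
      ≡⟨ cong₂ _+_ (sym (∑<-+ (suc N) _ _)) (sym diagonal) ⟩
    ∑< (suc N) (λ i → ∑< (suc (N ∸ i)) (λ j → G i (i +ℕ j)) + G i (suc N)) + ∑< (suc (suc N ∸ suc N)) (λ j → G (suc N) (suc N +ℕ j))
      ≡⟨ cong (_+ ∑< (suc (suc N ∸ suc N)) (λ j → G (suc N) (suc N +ℕ j))) (∑<-cong (suc N) (λ i i<N+1 → sym (row i i<N+1))) ⟩
    ∑< (suc N) (λ i → ∑< (suc (suc N ∸ i)) (λ j → G i (i +ℕ j))) + ∑< (suc (suc N ∸ suc N)) (λ j → G (suc N) (suc N +ℕ j))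
      ≡⟨ ∑<-last (suc N) _ ⟨
    ∑< (suc (suc N)) (λ i → ∑< (suc (suc N ∸ i)) (λ j → G i (i +ℕ j))) ∎
    where
    open ≡-Reasoning
    diagonal : ∑< (suc (suc N ∸ suc N)) (λ j → G (suc N) (suc N +ℕ j)) ≡ G (suc N) (suc N)
    diagonal = trans (cong (λ u → ∑< (suc u) (λ j → G (suc N) (suc N +ℕ j))) (ℕ.n∸n≡0 N))
                     (trans (∑<-one _) (cong (G (suc N)) (ℕ.+-identityʳ (suc N))))
    row : ∀ i → i < suc N → ∑< (suc (suc N ∸ i)) (λ j → G i (i +ℕ j)) ≡ ∑< (suc (N ∸ i)) (λ j → G i (i +ℕ j)) + G i (suc N)
    row i i<N+1 = begin
      ∑< (suc (suc N ∸ i)) (λ j → G i (i +ℕ j))          ≡⟨ cong (λ u → ∑< (suc u) (λ j → G i (i +ℕ j))) (ℕ.+-∸-assoc 1 (ℕ.≤-pred i<N+1)) ⟩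
      ∑< (suc (suc (N ∸ i))) (λ j → G i (i +ℕ j))        ≡⟨ ∑<-last (suc (N ∸ i)) _ ⟩
      ∑< (suc (N ∸ i)) (λ j → G i (i +ℕ j)) + G i (i +ℕ suc (N ∸ i))
        ≡⟨ cong (λ u → ∑< (suc (N ∸ i)) (λ j → G i (i +ℕ j)) + G i u) (trans (ℕ.+-suc i (N ∸ i)) (cong suc (ℕ.m+[n∸m]≡n (ℕ.≤-pred i<N+1)))) ⟩
      ∑< (suc (N ∸ i)) (λ j → G i (i +ℕ j)) + G i (suc N) ∎

  evHP : ℕ → HP → F → F → F
  evHP N H x y = ∑< (suc N) (λ k → H k * (x ^ (N ∸ k) * y ^ k))

  evHP-raise : ∀ s e (B : HP) x y → (∀ j → s < j → B j ≡ 0F) → evHP (s +ℕ e) B x y ≡ x ^ e * evHP s B x y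
  evHP-raise s e B x y B-support = begin
    ∑< (suc s +ℕ e) (λ j → B j * (x ^ ((s +ℕ e) ∸ j) * y ^ j))
      ≡⟨ ∑<-split (suc s) e _ ⟩
    ∑< (suc s) (λ j → B j * (x ^ ((s +ℕ e) ∸ j) * y ^ j)) + ∑< e (λ j → B (suc s +ℕ j) * (x ^ ((s +ℕ e) ∸ (suc s +ℕ j)) * y ^ (suc s +ℕ j)))
      ≡⟨ cong₂ _+_ (∑<-cong (suc s) (λ j j<s+1 → term j (ℕ.≤-pred j<s+1)))
                   (∑<-zero e _ (λ j _ → trans (cong (_* _) (B-support (suc s +ℕ j) (s≤s (ℕ.m≤m+n s j)))) (zeroˡ _))) ⟩
    ∑< (suc s) (λ j → x ^ e * (B j * (x ^ (s ∸ j) * y ^ j))) + 0F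
      ≡⟨ trans (+-identityʳ _) (∑<-*ˡ (suc s) (x ^ e) _) ⟩
    x ^ e * evHP s B x y ∎
    where
    open ≡-Reasoning
    term : ∀ j → j ≤ s → B j * (x ^ ((s +ℕ e) ∸ j) * y ^ j) ≡ x ^ e * (B j * (x ^ (s ∸ j) * y ^ j))
    term j j≤s = begin
      B j * (x ^ ((s +ℕ e) ∸ j) * y ^ j)       ≡⟨ cong (λ u → B j * (x ^ u * y ^ j)) (trans (ℕ.+-∸-comm e j≤s) (ℕ.+-comm (s ∸ j) e)) ⟩
      B j * (x ^ (e +ℕ (s ∸ j)) * y ^ j)       ≡⟨ cong (λ u → B j * (u * y ^ j)) (^-homo-* x e (s ∸ j)) ⟩
      B j * (x ^ e * x ^ (s ∸ j) * y ^ j)      ≡⟨ solve 4 (λ b a c y → b :* ((a :* c) :* y) := a :* (b :* (c :* y))) refl (B j) (x ^ e) (x ^ (s ∸ j)) (y ^ j) ⟩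
      x ^ e * (B j * (x ^ (s ∸ j) * y ^ j))    ∎

  mulHP≡∑< : ∀ A B k → mulHP A B k ≡ ∑< (suc k) (λ i → A i * B (k ∸ i))
  mulHP≡∑< A B k = trans (sumUpTo≡∑< k _) (∑<-cong (suc k) (λ i _ → *F≡* (A i) (B (k ∸ i))))
    where
    sumUpTo≡∑< : ∀ N (f : ℕ → F) → sumUpTo N f ≡ ∑< (suc N) f
    sumUpTo≡∑< zero f = sym (∑<-one f)
    sumUpTo≡∑< (suc N) f = trans (+F≡+ (sumUpTo N f) (f (suc N)))
                                 (trans (cong (_+ f (suc N)) (sumUpTo≡∑< N f)) (sym (∑<-last (suc N) f)))

  evHP-mulHP : ∀ r s (A B : HP) x y → (∀ i → r < i → A i ≡ 0F) → (∀ j → s < j → B j ≡ 0F) →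
               evHP (r +ℕ s) (mulHP A B) x y ≡ evHP r A x y * evHP s B x y
  evHP-mulHP r s A B x y A-support B-support = begin
    evHP N (mulHP A B) x y
      ≡⟨ ∑<-cong (suc N) (λ k _ → trans (cong (_* X N k) (mulHP≡∑< A B k)) (sym (∑<-*ʳ (suc k) (X N k) _))) ⟩
    ∑< (suc N) (λ k → ∑< (suc k) (λ i → A i * B (k ∸ i) * X N k))
      ≡⟨ ∑<-triangle N (λ i k → A i * B (k ∸ i) * X N k) ⟩
    ∑< (suc N) (λ i → ∑< (suc (N ∸ i)) (λ j → A i * B ((i +ℕ j) ∸ i) * X N (i +ℕ j)))
      ≡⟨ ∑<-cong (suc N) (λ i i<N+1 → inner i (ℕ.≤-pred i<N+1)) ⟩
    ∑< (suc r +ℕ s) (λ i → A i * (y ^ i * evHP (N ∸ i) B x y))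
      ≡⟨ ∑<-split (suc r) s _ ⟩
    ∑< (suc r) (λ i → A i * (y ^ i * evHP (N ∸ i) B x y)) + ∑< s (λ j → A (suc r +ℕ j) * (y ^ (suc r +ℕ j) * evHP (N ∸ (suc r +ℕ j)) B x y))
      ≡⟨ cong₂ _+_ (∑<-cong (suc r) (λ i i<r+1 → outer i (ℕ.≤-pred i<r+1)))
                   (∑<-zero s _ (λ j _ → trans (cong (_* (y ^ (suc r +ℕ j) * evHP (N ∸ (suc r +ℕ j)) B x y)) (A-support (suc r +ℕ j) (s≤s (ℕ.m≤m+n r j)))) (zeroˡ _))) ⟩
    ∑< (suc r) (λ i → (A i * (x ^ (r ∸ i) * y ^ i)) * evHP s B x y) + 0F
      ≡⟨ trans (+-identityʳ _) (∑<-*ʳ (suc r) _ _) ⟩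
    evHP r A x y * evHP s B x y ∎
    where
    open ≡-Reasoning
    N = r +ℕ s
    X : ℕ → ℕ → F
    X M k = x ^ (M ∸ k) * y ^ k
    inner : ∀ i → i ≤ N → ∑< (suc (N ∸ i)) (λ j → A i * B ((i +ℕ j) ∸ i) * X N (i +ℕ j)) ≡ A i * (y ^ i * evHP (N ∸ i) B x y)
    inner i i≤N = begin
      ∑< (suc (N ∸ i)) (λ j → A i * B ((i +ℕ j) ∸ i) * X N (i +ℕ j))
        ≡⟨ ∑<-cong (suc (N ∸ i)) (λ j _ → term j) ⟩
      ∑< (suc (N ∸ i)) (λ j → A i * (y ^ i * (B j * X (N ∸ i) j)))
        ≡⟨ trans (∑<-*ˡ (suc (N ∸ i)) (A i) _) (cong (A i *_) (∑<-*ˡ (suc (N ∸ i)) (y ^ i) _)) ⟩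
      A i * (y ^ i * evHP (N ∸ i) B x y) ∎
      where
      term : ∀ j → A i * B ((i +ℕ j) ∸ i) * X N (i +ℕ j) ≡ A i * (y ^ i * (B j * X (N ∸ i) j))
      term j = begin
        A i * B ((i +ℕ j) ∸ i) * (x ^ (N ∸ (i +ℕ j)) * y ^ (i +ℕ j))
          ≡⟨ cong₂ (λ u v → A i * B u * (x ^ v * y ^ (i +ℕ j))) (ℕ.m+n∸m≡n i j) (sym (ℕ.∸-+-assoc N i j)) ⟩
        A i * B j * (x ^ (N ∸ i ∸ j) * y ^ (i +ℕ j))
          ≡⟨ cong (λ u → A i * B j * (x ^ (N ∸ i ∸ j) * u)) (^-homo-* y i j) ⟩
        A i * B j * (x ^ (N ∸ i ∸ j) * (y ^ i * y ^ j))
          ≡⟨ solve 5 (λ a b c u v → a :* b :* (c :* (u :* v)) := a :* (u :* (b :* (c :* v)))) refl (A i) (B j) (x ^ (N ∸ i ∸ j)) (y ^ i) (y ^ j) ⟩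
        A i * (y ^ i * (B j * X (N ∸ i) j)) ∎
    outer : ∀ i → i ≤ r → A i * (y ^ i * evHP (N ∸ i) B x y) ≡ (A i * (x ^ (r ∸ i) * y ^ i)) * evHP s B x y
    outer i i≤r = begin
      A i * (y ^ i * evHP (N ∸ i) B x y)             ≡⟨ cong (λ u → A i * (y ^ i * evHP u B x y)) (trans (ℕ.+-∸-comm s i≤r) (ℕ.+-comm (r ∸ i) s)) ⟩
      A i * (y ^ i * evHP (s +ℕ (r ∸ i)) B x y)      ≡⟨ cong (λ u → A i * (y ^ i * u)) (evHP-raise s (r ∸ i) B x y B-support) ⟩
      A i * (y ^ i * (x ^ (r ∸ i) * evHP s B x y))   ≡⟨ solve 4 (λ a b c e → a :* (b :* (c :* e)) := (a :* (c :* b)) :* e) refl (A i) (y ^ i) (x ^ (r ∸ i)) (evHP s B x y) ⟩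
      (A i * (x ^ (r ∸ i) * y ^ i)) * evHP s B x y   ∎

  lin-support : ∀ α β i → 1 < i → lin α β i ≡ 0F
  lin-support α β (suc zero) (s≤s ())
  lin-support α β (suc (suc i)) _ = refl

  evHP-lin : ∀ α β x y → evHP 1 (lin α β) x y ≡ α * x + β * y
  evHP-lin α β x y = begin
    evHP 1 (lin α β) x y                                    ≡⟨ ∑<-suc 1 _ ⟩
    α * (x ^ 1 * 1F) + ∑< 1 (λ k → lin α β (suc k) * (x ^ (1 ∸ suc k) * y ^ suc k))
                                                            ≡⟨ cong (α * (x ^ 1 * 1F) +_) (∑<-one _) ⟩
    α * (x * 1F * 1F) + β * (1F * (y * 1F))                 ≡⟨ solve 4 (λ α β x y → α :* (x :* con (ℤ.+ 1) :* con (ℤ.+ 1)) :+ β :* (con (ℤ.+ 1) :* (y :* con (ℤ.+ 1)))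
                                                                                  := α :* x :+ β :* y) refl α β x y ⟩
    α * x + β * y                                           ∎
    where open ≡-Reasoning

  powLin-support : ∀ α β r k → r < k → powLin α β r k ≡ 0F
  powLin-support α β zero (suc k) _ = refl
  powLin-support α β (suc r) k r<k = trans (mulHP≡∑< (lin α β) (powLin α β r) k) (∑<-zero (suc k) _ (λ i i<k+1 → term i (ℕ.≤-pred i<k+1)))
    where
    term : ∀ i → i ≤ k → lin α β i * powLin α β r (k ∸ i) ≡ 0F
    term zero _ = trans (cong (α *_) (powLin-support α β r k (ℕ.<-trans (ℕ.n<1+n r) r<k))) (zeroʳ α)
    term (suc zero) _ = trans (cong (β *_) (powLin-support α β r (k ∸ 1) (ℕ.≤-trans (ℕ.≤-reflexive (sym (ℕ.m+n∸m≡n 1 (suc r)))) (ℕ.∸-monoˡ-≤ 1 r<k)))) (zeroʳ β)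
    term (suc (suc i)) _ = zeroˡ _

  evHP-powLin : ∀ α β r x y → evHP r (powLin α β r) x y ≡ (α * x + β * y) ^ r
  evHP-powLin α β zero x y = trans (∑<-one _) (solve 0 (con (ℤ.+ 1) :* (con (ℤ.+ 1) :* con (ℤ.+ 1)) := con (ℤ.+ 1)) refl)
  evHP-powLin α β (suc r) x y = begin
    evHP (1 +ℕ r) (mulHP (lin α β) (powLin α β r)) x y    ≡⟨ evHP-mulHP 1 r (lin α β) (powLin α β r) x y (lin-support α β) (powLin-support α β r) ⟩
    evHP 1 (lin α β) x y * evHP r (powLin α β r) x y      ≡⟨ cong₂ _*_ (evHP-lin α β x y) (evHP-powLin α β r x y) ⟩
    (α * x + β * y) * (α * x + β * y) ^ r                 ∎
    where open ≡-Reasoning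

  evHP-powLin*powLin : ∀ k i α β γ δ x y → i ≤ k →
    evHP k (mulHP (powLin α β (k ∸ i)) (powLin γ δ i)) x y ≡ (α * x + β * y) ^ (k ∸ i) * (γ * x + δ * y) ^ i
  evHP-powLin*powLin k i α β γ δ x y i≤k = begin
    evHP k (mulHP A B) x y                       ≡⟨ cong (λ u → evHP u (mulHP A B) x y) (ℕ.m∸n+n≡m i≤k) ⟨
    evHP ((k ∸ i) +ℕ i) (mulHP A B) x y          ≡⟨ evHP-mulHP (k ∸ i) i A B x y (powLin-support α β (k ∸ i)) (powLin-support γ δ i) ⟩
    evHP (k ∸ i) A x y * evHP i B x y            ≡⟨ cong₂ _*_ (evHP-powLin α β (k ∸ i) x y) (evHP-powLin γ δ i x y) ⟩
    (α * x + β * y) ^ (k ∸ i) * (γ * x + δ * y) ^ i ∎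
    where
    open ≡-Reasoning
    A = powLin α β (k ∸ i)
    B = powLin γ δ i

  ev-actV : ∀ {k} a b c d (P : V k) x y →
            ev (actV (mat a b c d) P) x y ≡ ev P (ofℤ a * x + ofℤ c * y) (ofℤ b * x + ofℤ d * y)
  ev-actV {k} a b c d P x y = begin
    ∑ (λ j → actV (mat a b c d) P j * X (toℕ j))
      ≡⟨ ∑-cong (λ j → cong (_* X (toℕ j)) (trans (sumFin≡∑ _) (∑-cong (λ i → *F≡* (P i) _)))) ⟩
    ∑ (λ j → ∑ (λ i → P i * Q i (toℕ j)) * X (toℕ j))
      ≡⟨ ∑-cong (λ j → trans (sym (∑-*ʳ _ _)) (∑-cong (λ i → *-assoc _ _ _))) ⟩
    ∑ (λ j → ∑ (λ i → P i * (Q i (toℕ j) * X (toℕ j))))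
      ≡⟨ ∑-swap _ ⟩
    ∑ (λ i → ∑ (λ j → P i * (Q i (toℕ j) * X (toℕ j))))
      ≡⟨ ∑-cong (λ i → trans (∑-*ˡ (P i) _) (cong (P i *_) (sym (∑<≡∑ (suc k) (λ j → Q i j * X j))))) ⟩
    ∑ (λ i → P i * evHP k (Q i) x y)
      ≡⟨ ∑-cong (λ i → cong (P i *_) (evHP-powLin*powLin k (toℕ i) α γ β δ x y (ℕ.≤-pred (toℕ<n i)))) ⟩
    ev P (α * x + γ * y) (β * x + δ * y) ∎
    where
    open ≡-Reasoning
    α = ofℤ a
    β = ofℤ b
    γ = ofℤ c
    δ = ofℤ d
    X : ℕ → F
    X j = x ^ (k ∸ j) * y ^ j
    Q : Fin (suc k) → HP
    Q i = mulHP (powLin α γ (k ∸ toℕ i)) (powLin β δ (toℕ i))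

module Duality (n : ℕ) (isPrime : Prime (suc (suc n))) (d : ℕ) (d≤p-1 : d ≤ suc n) where

  open Forms n isPrime public

  m : ℕ
  m = suc n ∸ d

  m≤p-1 : m ≤ suc n
  m≤p-1 = ℕ.m∸n≤m (suc n) d

  d+m≡p-1 : d +ℕ m ≡ suc n
  d+m≡p-1 = ℕ.m+[n∸m]≡n d≤p-1

  p-1∸m≡d : suc n ∸ m ≡ d
  p-1∸m≡d = ℕ.m∸[m∸n]≡n d≤p-1

  Homogeneous : ℕ → W → Set
  Homogeneous k f = ∀ l x y → ¬ l ≡ 0F → f (l * x) (l * y) ≡ l ^ k * f x y

  InU⇒Homogeneous : ∀ {k f} → InU k f → Homogeneous k f
  InU⇒Homogeneous {k} {f} (_ , homogeneous) l x y l≢0 = begin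
    f (l * x) (l * y)          ≡⟨ cong₂ f (*F≡* l x) (*F≡* l y) ⟨
    f (l *F x) (l *F y)        ≡⟨ homogeneous l x y l≢0 ⟩
    (l ^F k) *F f x y          ≡⟨ *F≡* _ _ ⟩
    (l ^F k) * f x y           ≡⟨ cong (_* f x y) (^F≡^ l k) ⟩
    l ^ k * f x y              ∎
    where open ≡-Reasoning

  Homogeneous⇒InU : ∀ {k f} → VanishesAt0 f → Homogeneous k f → InU k f
  Homogeneous⇒InU {k} {f} f00≡0 homogeneous = f00≡0 , λ l x y l≢0 → begin
    f (l *F x) (l *F y)        ≡⟨ cong₂ f (*F≡* l x) (*F≡* l y) ⟩
    f (l * x) (l * y)          ≡⟨ homogeneous l x y l≢0 ⟩
    l ^ k * f x y              ≡⟨ cong (_* f x y) (^F≡^ l k) ⟨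
    (l ^F k) * f x y           ≡⟨ *F≡* _ _ ⟨
    (l ^F k) *F f x y          ∎
    where open ≡-Reasoning

  ι∈U : ∀ (P : V d) → InU d (ι P)
  ι∈U P = Homogeneous⇒InU {d} refl (ι-homogeneous P)

  weight : Fin (suc m) → F
  weight i = (- 1F) ^ toℕ i * ⟪ m C toℕ i ⟫ ⁻¹

  weight⁻¹ : Fin (suc m) → F
  weight⁻¹ i = (- 1F) ^ toℕ i * ⟪ m C toℕ i ⟫

  ⟪mCi⟫≢0 : ∀ (i : Fin (suc m)) → ¬ ⟪ m C toℕ i ⟫ ≡ 0F
  ⟪mCi⟫≢0 i = ⟪C⟫≢0 m (toℕ i) (ℕ.≤-pred (toℕ<n i)) (s≤s m≤p-1)

  weight*weight⁻¹≡1 : ∀ i → weight i * weight⁻¹ i ≡ 1F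
  weight*weight⁻¹≡1 i = begin
    (s * c ⁻¹) * (s * c)       ≡⟨ solve 3 (λ s a c → (s :* a) :* (s :* c) := (s :* s) :* (a :* c)) refl s (c ⁻¹) c ⟩
    (s * s) * (c ⁻¹ * c)       ≡⟨ cong₂ _*_ (-1^*-1^ (toℕ i)) (x⁻¹*x≡1 c (⟪mCi⟫≢0 i)) ⟩
    1F * 1F                    ≡⟨ *-identityˡ 1F ⟩
    1F                         ∎
    where
    open ≡-Reasoning
    s = (- 1F) ^ toℕ i
    c = ⟪ m C toℕ i ⟫

  pairV≡weighted : ∀ (w Q : V m) → pairV w Q ≡ ∑ (λ i → (weight i * w i) * Q (opposite i))
  pairV≡weighted w Q = trans (sumFin≡∑ _) (∑-cong term)
    where
    term : ∀ i → ((signF (toℕ i) *F invF (ofℕ (m C toℕ i))) *F w i) *F Q (opposite i) ≡ (weight i * w i) * Q (opposite i)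
    term i = begin
      ((signF (toℕ i) *F invF (ofℕ (m C toℕ i))) *F w i) *F Q (opposite i)
        ≡⟨ trans (*F≡* _ _) (cong (_* Q (opposite i)) (trans (*F≡* _ _) (cong (_* w i) (*F≡* _ _)))) ⟩
      ((signF (toℕ i) * invF (ofℕ (m C toℕ i))) * w i) * Q (opposite i)
        ≡⟨ cong₂ (λ u v → ((u * v) * w i) * Q (opposite i)) (signF≡-1^ (toℕ i))
                 (trans (invF≡⁻¹ _) (cong _⁻¹ (ofℕ≡⟪⟫ (m C toℕ i)))) ⟩
      (weight i * w i) * Q (opposite i) ∎
      where open ≡-Reasoning

  pairW-ι≡moments : ∀ f (Q : V m) → VanishesAt0 f → pairW f (ι Q) ≡ ∑ (λ i → moment f (toℕ i) (m ∸ toℕ i) * Q (opposite i))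
  pairW-ι≡moments f Q f00≡0 = begin
    pairW f (ι Q)                                            ≡⟨ pairW≡pair f (ι Q) ⟩
    pair f (ι Q)                                             ≡⟨ pair-ι f Q f00≡0 ⟩
    pair f (ev Q)                                            ≡⟨ pair-ev f Q ⟩
    ∑ (λ k → Q k * moment f (m ∸ toℕ k) (toℕ k))             ≡⟨ ∑-opposite _ ⟨
    ∑ (λ i → Q (opposite i) * moment f (m ∸ toℕ (opposite i)) (toℕ (opposite i)))
                                                             ≡⟨ ∑-cong (λ i → trans (*-comm _ _) (cong (λ u → moment f (m ∸ u) u * Q (opposite i)) (opposite-prop i))) ⟩
    ∑ (λ i → moment f (m ∸ (m ∸ toℕ i)) (m ∸ toℕ i) * Q (opposite i))
                                                             ≡⟨ ∑-cong (λ i → cong (λ u → moment f u (m ∸ toℕ i) * Q (opposite i)) (ℕ.m∸[m∸n]≡n (ℕ.≤-pred (toℕ<n i)))) ⟩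
    ∑ (λ i → moment f (toℕ i) (m ∸ toℕ i) * Q (opposite i))  ∎
    where open ≡-Reasoning

  MomentsMatch : W → V m → Set
  MomentsMatch f w = ∀ i → weight i * w i ≡ moment f (toℕ i) (m ∸ toℕ i)

  MomentsMatch⇒IsPhi : ∀ f w → VanishesAt0 f → MomentsMatch f w → IsPhi d f w
  MomentsMatch⇒IsPhi f w f00≡0 match Q = begin
    pairV w Q                                                ≡⟨ pairV≡weighted w Q ⟩
    ∑ (λ i → (weight i * w i) * Q (opposite i))              ≡⟨ ∑-cong (λ i → cong (_* Q (opposite i)) (match i)) ⟩
    ∑ (λ i → moment f (toℕ i) (m ∸ toℕ i) * Q (opposite i))  ≡⟨ pairW-ι≡moments f Q f00≡0 ⟨
    pairW f (ι Q)                                            ∎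
    where open ≡-Reasoning

  indicator : ∀ {k} → Fin k → Fin k → F
  indicator j i with i Fin.≟ j
  ... | yes _ = 1F
  ... | no _ = 0F

  indicator-≡ : ∀ {k} (j : Fin k) → indicator j j ≡ 1F
  indicator-≡ j with j Fin.≟ j
  ... | yes _ = refl
  ... | no j≢j = ⊥-elim (j≢j refl)

  indicator-opposite-≢ : ∀ {k} (j i : Fin (suc k)) → ¬ i ≡ j → indicator (opposite j) (opposite i) ≡ 0F
  indicator-opposite-≢ j i i≢j with opposite i Fin.≟ opposite j
  ... | yes eq = ⊥-elim (i≢j (trans (sym (opposite-involutive i)) (trans (cong opposite eq) (opposite-involutive j))))
  ... | no _ = refl

  ∑-against-indicator : ∀ (g : Fin (suc m) → F) j → ∑ (λ i → g i * indicator (opposite j) (opposite i)) ≡ g j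
  ∑-against-indicator g j = begin
    ∑ (λ i → g i * indicator (opposite j) (opposite i))   ≡⟨ ∑-single _ j (λ i i≢j → trans (cong (g i *_) (indicator-opposite-≢ j i i≢j)) (zeroʳ _)) ⟩
    g j * indicator (opposite j) (opposite j)            ≡⟨ cong (g j *_) (indicator-≡ (opposite j)) ⟩
    g j * 1F                                             ≡⟨ *-identityʳ _ ⟩
    g j                                                  ∎
    where open ≡-Reasoning

  IsPhi⇒MomentsMatch : ∀ f w → VanishesAt0 f → IsPhi d f w → MomentsMatch f w
  IsPhi⇒MomentsMatch f w f00≡0 isPhi j = begin
    weight j * w j                                       ≡⟨ ∑-against-indicator _ j ⟨
    ∑ (λ i → (weight i * w i) * Q (opposite i))          ≡⟨ pairV≡weighted w Q ⟨
    pairV w Q                                            ≡⟨ isPhi Q ⟩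
    pairW f (ι Q)                                        ≡⟨ pairW-ι≡moments f Q f00≡0 ⟩
    ∑ (λ i → moment f (toℕ i) (m ∸ toℕ i) * Q (opposite i)) ≡⟨ ∑-against-indicator _ j ⟩
    moment f (toℕ j) (m ∸ toℕ j)                         ∎
    where
    open ≡-Reasoning
    Q = indicator (opposite j)

  φ : W → V m
  φ f i = weight⁻¹ i * moment f (toℕ i) (m ∸ toℕ i)

  φ-IsPhi : ∀ f → VanishesAt0 f → IsPhi d f (φ f)
  φ-IsPhi f f00≡0 = MomentsMatch⇒IsPhi f (φ f) f00≡0 (λ i → begin
    weight i * (weight⁻¹ i * moment f (toℕ i) (m ∸ toℕ i))    ≡⟨ *-assoc _ _ _ ⟨
    (weight i * weight⁻¹ i) * moment f (toℕ i) (m ∸ toℕ i)    ≡⟨ cong (_* moment f (toℕ i) (m ∸ toℕ i)) (weight*weight⁻¹≡1 i) ⟩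
    1F * moment f (toℕ i) (m ∸ toℕ i)                         ≡⟨ *-identityˡ _ ⟩
    moment f (toℕ i) (m ∸ toℕ i)                              ∎)
    where open ≡-Reasoning

  IsPhi-unique : ∀ f w w′ → VanishesAt0 f → IsPhi d f w → IsPhi d f w′ → w ≗V w′
  IsPhi-unique f w w′ f00≡0 isPhi isPhi′ j =
    *-cancelˡ (weight j) (w j) (w′ j) weight≢0
      (trans (IsPhi⇒MomentsMatch f w f00≡0 isPhi j) (sym (IsPhi⇒MomentsMatch f w′ f00≡0 isPhi′ j)))
    where
    weight≢0 : ¬ weight j ≡ 0F
    weight≢0 weight≡0 = 1≢0 (trans (sym (weight*weight⁻¹≡1 j)) (trans (cong (_* weight⁻¹ j) weight≡0) (zeroˡ _)))

  IsPhi-resp-≗V : ∀ f w w′ → VanishesAt0 f → w ≗V w′ → IsPhi d f w → IsPhi d f w′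
  IsPhi-resp-≗V f w w′ f00≡0 w≗w′ isPhi = MomentsMatch⇒IsPhi f w′ f00≡0
    (λ i → trans (cong (weight i *_) (sym (w≗w′ i))) (IsPhi⇒MomentsMatch f w f00≡0 isPhi i))

  S*S≡0-complementary : ∀ e₁ e₂ → e₁ +ℕ e₂ ≡ suc n → S e₁ * S e₂ ≡ 0F
  S*S≡0-complementary e₁ e₂ e₁+e₂≡p-1 with ℕ.m≤n⇒m<n∨m≡n (subst (e₂ ≤_) e₁+e₂≡p-1 (ℕ.m≤n+m e₂ e₁))
  ... | inj₁ e₂<p-1 = trans (cong (S e₁ *_) (S≡0 e₂ e₂<p-1)) (zeroʳ _)
  ... | inj₂ refl = trans (cong (λ e → S e * S (suc n)) (ℕ.+-cancelʳ-≡ (suc n) e₁ 0 e₁+e₂≡p-1))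
                          (trans (cong (_* S (suc n)) S0≡0) (zeroˡ _))

  moment-ev-complementary : ∀ (P : V d) a b → a +ℕ b ≡ m → moment (ev P) a b ≡ 0F
  moment-ev-complementary P a b a+b≡m = begin
    moment (ev P) a b                                      ≡⟨ pair-comm (ev P) (monomial a b) ⟩
    pair (monomial a b) (ev P)                             ≡⟨ pair-ev (monomial a b) P ⟩
    ∑ (λ k → P k * moment (monomial a b) (d ∸ toℕ k) (toℕ k)) ≡⟨ ∑-zero _ (λ k → trans (cong (P k *_) (term k)) (zeroʳ (P k))) ⟩
    0F                                                     ∎
    where
    open ≡-Reasoning
    term : ∀ k → moment (monomial a b) (d ∸ toℕ k) (toℕ k) ≡ 0F
    term k = trans (moment-monomial a b (d ∸ toℕ k) (toℕ k)) (S*S≡0-complementary (a +ℕ (d ∸ toℕ k)) (b +ℕ toℕ k) (begin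
      (a +ℕ (d ∸ toℕ k)) +ℕ (b +ℕ toℕ k)     ≡⟨ +-interchange a (d ∸ toℕ k) b (toℕ k) ⟩
      (a +ℕ b) +ℕ ((d ∸ toℕ k) +ℕ toℕ k)     ≡⟨ cong₂ _+ℕ_ a+b≡m (ℕ.m∸n+n≡m (ℕ.≤-pred (toℕ<n k))) ⟩
      m +ℕ d                                 ≡⟨ trans (ℕ.+-comm m d) d+m≡p-1 ⟩
      suc n                                  ∎))

  moment-ι-complementary : ∀ (P : V d) a b → a +ℕ b ≡ m → moment (ι P) a b ≡ 0F
  moment-ι-complementary P a b a+b≡m with d ℕ.≟ 0
  ... | no d≢0 = trans (pair-cong (ι≡ev P (ℕ.n≢0⇒n>0 d≢0)) (λ _ _ → refl)) (moment-ev-complementary P a b a+b≡m)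
  ... | yes d≡0 = begin
    moment (ι P) a b                 ≡⟨ pair-comm (ι P) (monomial a b) ⟩
    pair (monomial a b) (ι P)        ≡⟨ pair-ι (monomial a b) P (0^a*0^b≡0 a b 0<a+b) ⟩
    pair (monomial a b) (ev P)       ≡⟨ pair-comm (monomial a b) (ev P) ⟩
    moment (ev P) a b                ≡⟨ moment-ev-complementary P a b a+b≡m ⟩
    0F                               ∎
    where
    open ≡-Reasoning
    0<a+b : 0 < a +ℕ b
    0<a+b = subst (0 <_) (sym (trans a+b≡m (cong (suc n ∸_) d≡0))) (s≤s z≤n)

  φ∘ι≡0 : ∀ (P : V d) → IsPhi d (ι P) 0V
  φ∘ι≡0 P = MomentsMatch⇒IsPhi (ι P) 0V refl (λ i →
    trans (zeroʳ _) (sym (moment-ι-complementary P (toℕ i) (m ∸ toℕ i) (ℕ.m+[n∸m]≡n (ℕ.≤-pred (toℕ<n i))))))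

  moment-∑ : ∀ {k} (c : Fin k → F) (g : Fin k → W) a b →
             moment (λ x y → ∑ (λ j → c j * g j x y)) a b ≡ ∑ (λ j → c j * moment (g j) a b)
  moment-∑ c g a b = begin
    ∑ (λ x → ∑ (λ y → ∑ (λ j → c j * g j x y) * monomial a b x y))
      ≡⟨ ∑-cong (λ x → ∑-cong (λ y → trans (sym (∑-*ʳ _ _)) (∑-cong (λ j → *-assoc _ _ _)))) ⟩
    ∑ (λ x → ∑ (λ y → ∑ (λ j → c j * (g j x y * monomial a b x y))))
      ≡⟨ ∑-cong (λ x → ∑-swap _) ⟩
    ∑ (λ x → ∑ (λ j → ∑ (λ y → c j * (g j x y * monomial a b x y))))
      ≡⟨ ∑-swap _ ⟩
    ∑ (λ j → ∑ (λ x → ∑ (λ y → c j * (g j x y * monomial a b x y))))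
      ≡⟨ ∑-cong (λ j → trans (∑-cong (λ x → ∑-*ˡ (c j) _)) (∑-*ˡ (c j) _)) ⟩
    ∑ (λ j → c j * moment (g j) a b) ∎
    where open ≡-Reasoning

  probeCombination : (Fin (suc m) → F) → W
  probeCombination c x y = ∑ (λ j → c j * coefficientProbe m (toℕ j) x y)

  moment-probeCombination : ∀ c (k : Fin (suc m)) → moment (probeCombination c) (m ∸ toℕ k) (toℕ k) ≡ c k
  moment-probeCombination c k = begin
    moment (probeCombination c) (m ∸ toℕ k) (toℕ k)
      ≡⟨ moment-∑ c (coefficientProbe m ∘ toℕ) (m ∸ toℕ k) (toℕ k) ⟩
    ∑ (λ j → c j * moment (coefficientProbe m (toℕ j)) (m ∸ toℕ k) (toℕ k))
      ≡⟨ ∑-single _ k (λ j j≢k → trans (cong (c j *_) (moment-coefficientProbe-≢ m k j m≤p-1 (j≢k ∘ sym))) (zeroʳ _)) ⟩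
    c k * moment (coefficientProbe m (toℕ k)) (m ∸ toℕ k) (toℕ k)
      ≡⟨ cong (c k *_) (moment-coefficientProbe-≡ m k m≤p-1) ⟩
    c k * 1F
      ≡⟨ *-identityʳ _ ⟩
    c k ∎
    where open ≡-Reasoning

  -- The probes for degree m have total degree d + (p - 1), hence are homogeneous of degree d by Fermat.
  coefficientProbe-homogeneous : ∀ j → j ≤ suc n → Homogeneous d (coefficientProbe m j)
  coefficientProbe-homogeneous j j≤p-1 l x y l≢0 = begin
    (l * x) ^ a * (l * y) ^ b               ≡⟨ cong₂ _*_ (^-distrib-* l x a) (^-distrib-* l y b) ⟩
    (l ^ a * x ^ a) * (l ^ b * y ^ b)       ≡⟨ solve 4 (λ p q r s → (p :* q) :* (r :* s) := (p :* r) :* (q :* s)) refl (l ^ a) (x ^ a) (l ^ b) (y ^ b) ⟩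
    (l ^ a * l ^ b) * (x ^ a * y ^ b)       ≡⟨ cong (_* (x ^ a * y ^ b)) (^-homo-* l a b) ⟨
    l ^ (a +ℕ b) * (x ^ a * y ^ b)          ≡⟨ cong (λ e → l ^ e * (x ^ a * y ^ b)) a+b≡d+p-1 ⟩
    l ^ (d +ℕ suc n) * (x ^ a * y ^ b)      ≡⟨ cong (_* (x ^ a * y ^ b)) (^-homo-* l d (suc n)) ⟩
    (l ^ d * l ^ suc n) * (x ^ a * y ^ b)   ≡⟨ cong (λ u → (l ^ d * u) * (x ^ a * y ^ b)) (fermat l l≢0) ⟩
    (l ^ d * 1F) * (x ^ a * y ^ b)          ≡⟨ cong (_* (x ^ a * y ^ b)) (*-identityʳ _) ⟩
    l ^ d * (x ^ a * y ^ b)                 ∎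
    where
    open ≡-Reasoning
    a = (suc n ∸ m) +ℕ j
    b = suc n ∸ j
    a+b≡d+p-1 : a +ℕ b ≡ d +ℕ suc n
    a+b≡d+p-1 = trans (ℕ.+-assoc (suc n ∸ m) j b) (cong₂ _+ℕ_ p-1∸m≡d (ℕ.m+[n∸m]≡n j≤p-1))

  probeCombination∈U : ∀ c → InU d (probeCombination c)
  probeCombination∈U c = Homogeneous⇒InU {d} vanishes homogeneous
    where
    j≤p-1 : ∀ (j : Fin (suc m)) → toℕ j ≤ suc n
    j≤p-1 j = ℕ.≤-trans (ℕ.≤-pred (toℕ<n j)) m≤p-1
    vanishes : VanishesAt0 (probeCombination c)
    vanishes = ∑-zero _ (λ j → trans (cong (c j *_) (coefficientProbe-origin m (toℕ j) (j≤p-1 j))) (zeroʳ _))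
    homogeneous : Homogeneous d (probeCombination c)
    homogeneous l x y l≢0 = trans (∑-cong (λ j → trans (cong (c j *_) (coefficientProbe-homogeneous (toℕ j) (j≤p-1 j) l x y l≢0))
                                                       (solve 3 (λ a b e → a :* (b :* e) := b :* (a :* e)) refl (c j) (l ^ d) _)))
                                  (∑-*ˡ (l ^ d) _)

  φ-surjective : ∀ (w : V m) → Σ W (λ f → InU d f × IsPhi d f w)
  φ-surjective w = f , probeCombination∈U c , MomentsMatch⇒IsPhi f w (proj₁ (probeCombination∈U c)) match
    where
    c : Fin (suc m) → F
    c k = weight (opposite k) * w (opposite k)
    f = probeCombination c
    match : MomentsMatch f w
    match i = begin
      weight i * w i                                           ≡⟨ cong (λ j → weight j * w j) (opposite-involutive i) ⟨
      c (opposite i)                                           ≡⟨ moment-probeCombination c (opposite i) ⟨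
      moment f (m ∸ toℕ (opposite i)) (toℕ (opposite i))       ≡⟨ cong (λ e → moment f (m ∸ e) e) (opposite-prop i) ⟩
      moment f (m ∸ (m ∸ toℕ i)) (m ∸ toℕ i)                   ≡⟨ cong (λ e → moment f e (m ∸ toℕ i)) (ℕ.m∸[m∸n]≡n (ℕ.≤-pred (toℕ<n i))) ⟩
      moment f (toℕ i) (m ∸ toℕ i)                             ∎
      where open ≡-Reasoning

  lineMoment : W → ℕ → F
  lineMoment h b = ∑ (λ t → h 1F t * t ^ b)

  module _ {h : W} (h00≡0 : VanishesAt0 h) (homogeneous : Homogeneous d h) where

    h-on-axis : ∀ y → ¬ y ≡ 0F → h 0F y ≡ y ^ d * h 0F 1F
    h-on-axis y y≢0 = trans (cong₂ h (sym (zeroʳ y)) (sym (*-identityʳ y))) (homogeneous y 0F 1F y≢0)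

    h-on-line : ∀ x t → ¬ x ≡ 0F → h x (t * x) ≡ x ^ d * h 1F t
    h-on-line x t x≢0 = trans (cong₂ h (sym (*-identityʳ x)) (*-comm t x)) (homogeneous x 1F t x≢0)

    module _ (a b : ℕ) (x^e≡1 : ∀ x → ¬ x ≡ 0F → x ^ (d +ℕ a +ℕ b) ≡ 1F) where

      column-0 : ∑ (λ y → h 0F y * monomial a b 0F y) ≡ - (0F ^ a * h 0F 1F)
      column-0 = begin
        ∑ (λ y → h 0F y * monomial a b 0F y)                     ≡⟨ ∑-suc _ ⟩
        h 0F 0F * monomial a b 0F 0F + ∑ (λ i → h 0F (fs i) * monomial a b 0F (fs i))
                                                                 ≡⟨ cong₂ _+_ (trans (cong (_* _) h00≡0) (zeroˡ _)) (∑-cong (λ i → term (fs i) (λ ()))) ⟩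
        0F + ∑ (λ i → 0F ^ a * h 0F 1F * fs i ^ (d +ℕ b))         ≡⟨ trans (+-identityˡ _) (∑-*ˡ _ _) ⟩
        0F ^ a * h 0F 1F * σ                                     ≡⟨ edge a x^e≡1 ⟩
        - (0F ^ a * h 0F 1F)                                     ∎
        where
        open ≡-Reasoning
        σ : F
        σ = ∑ (λ (i : Fin (suc n)) → fs i ^ (d +ℕ b))
        term : ∀ y → ¬ y ≡ 0F → h 0F y * monomial a b 0F y ≡ 0F ^ a * h 0F 1F * y ^ (d +ℕ b)
        term y y≢0 = begin
          h 0F y * (0F ^ a * y ^ b)               ≡⟨ cong (_* (0F ^ a * y ^ b)) (h-on-axis y y≢0) ⟩
          y ^ d * h 0F 1F * (0F ^ a * y ^ b)      ≡⟨ solve 4 (λ u β z v → u :* β :* (z :* v) := z :* β :* (u :* v)) refl (y ^ d) (h 0F 1F) (0F ^ a) (y ^ b) ⟩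
          0F ^ a * h 0F 1F * (y ^ d * y ^ b)      ≡⟨ cong (0F ^ a * h 0F 1F *_) (^-homo-* y d b) ⟨
          0F ^ a * h 0F 1F * y ^ (d +ℕ b)         ∎
        edge : ∀ a → (∀ x → ¬ x ≡ 0F → x ^ (d +ℕ a +ℕ b) ≡ 1F) →
               0F ^ a * h 0F 1F * σ ≡ - (0F ^ a * h 0F 1F)
        edge zero x^e≡1 = begin
          1F * h 0F 1F * σ                        ≡⟨ cong (1F * h 0F 1F *_) (∑-cong (λ i → trans (cong (fs i ^_) (cong (_+ℕ b) (sym (ℕ.+-identityʳ d)))) (x^e≡1 (fs i) (λ ())))) ⟩
          1F * h 0F 1F * ∑ {suc n} (λ _ → 1F)     ≡⟨ cong (1F * h 0F 1F *_) (trans (∑-const (suc n) 1F) (trans (*-identityʳ _) ⟪p-1⟫)) ⟩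
          1F * h 0F 1F * - 1F                     ≡⟨ solve 1 (λ u → u :* (:- con (ℤ.+ 1)) := :- u) refl (1F * h 0F 1F) ⟩
          - (1F * h 0F 1F)                        ∎
          where open ≡-Reasoning
        edge (suc a) _ = begin
          0F ^ suc a * h 0F 1F * σ                ≡⟨ cong (λ u → u * h 0F 1F * σ) (0^suc a) ⟩
          0F * h 0F 1F * σ                        ≡⟨ solve 2 (λ β s → con (ℤ.+ 0) :* β :* s := :- (con (ℤ.+ 0) :* β)) refl (h 0F 1F) σ ⟩
          - (0F * h 0F 1F)                        ≡⟨ cong (λ u → - (u * h 0F 1F)) (0^suc a) ⟨
          - (0F ^ suc a * h 0F 1F)                ∎
          where open ≡-Reasoning

      column-≢0 : ∀ x → ¬ x ≡ 0F → ∑ (λ y → h x y * monomial a b x y) ≡ lineMoment h b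
      column-≢0 x x≢0 = begin
        ∑ (λ y → h x y * monomial a b x y)                     ≡⟨ ∑-affine x 0F x≢0 (λ y → h x y * monomial a b x y) ⟨
        ∑ (λ t → h x (t * x + 0F) * monomial a b x (t * x + 0F)) ≡⟨ ∑-cong term ⟩
        ∑ (λ t → x ^ (d +ℕ a +ℕ b) * (h 1F t * t ^ b))         ≡⟨ ∑-*ˡ _ _ ⟩
        x ^ (d +ℕ a +ℕ b) * lineMoment h b                     ≡⟨ cong (_* lineMoment h b) (x^e≡1 x x≢0) ⟩
        1F * lineMoment h b                                    ≡⟨ *-identityˡ _ ⟩
        lineMoment h b                                         ∎
        where
        open ≡-Reasoning
        term : ∀ t → h x (t * x + 0F) * monomial a b x (t * x + 0F) ≡ x ^ (d +ℕ a +ℕ b) * (h 1F t * t ^ b)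
        term t = begin
          h x (t * x + 0F) * (x ^ a * (t * x + 0F) ^ b)
            ≡⟨ cong (λ y → h x y * (x ^ a * y ^ b)) (+-identityʳ _) ⟩
          h x (t * x) * (x ^ a * (t * x) ^ b)
            ≡⟨ cong₂ (λ u v → u * (x ^ a * v)) (h-on-line x t x≢0) (^-distrib-* t x b) ⟩
          (x ^ d * h 1F t) * (x ^ a * (t ^ b * x ^ b))
            ≡⟨ solve 5 (λ D A T B X → (D :* A) :* (X :* (T :* B)) := ((D :* X) :* B) :* (A :* T)) refl (x ^ d) (h 1F t) (t ^ b) (x ^ b) (x ^ a) ⟩
          ((x ^ d * x ^ a) * x ^ b) * (h 1F t * t ^ b)
            ≡⟨ cong (_* (h 1F t * t ^ b)) (trans (cong (_* x ^ b) (sym (^-homo-* x d a))) (sym (^-homo-* x (d +ℕ a) b))) ⟩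
          x ^ (d +ℕ a +ℕ b) * (h 1F t * t ^ b) ∎

      moment-homogeneous : moment h a b ≡ - (lineMoment h b + 0F ^ a * h 0F 1F)
      moment-homogeneous = begin
        moment h a b                                                   ≡⟨ ∑-suc _ ⟩
        ∑ (λ y → h 0F y * monomial a b 0F y) + ∑ (λ i → ∑ (λ y → h (fs i) y * monomial a b (fs i) y))
                                                                       ≡⟨ cong₂ _+_ column-0 (∑-cong (λ i → column-≢0 (fs i) (λ ()))) ⟩
        - (0F ^ a * h 0F 1F) + ∑ {suc n} (λ _ → lineMoment h b)        ≡⟨ cong (- (0F ^ a * h 0F 1F) +_) (trans (∑-const (suc n) _) (cong (_* lineMoment h b) ⟪p-1⟫)) ⟩
        - (0F ^ a * h 0F 1F) + - 1F * lineMoment h b                   ≡⟨ solve 2 (λ u v → :- u :+ (:- con (ℤ.+ 1)) :* v := :- (v :+ u)) refl (0F ^ a * h 0F 1F) (lineMoment h b) ⟩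
        - (lineMoment h b + 0F ^ a * h 0F 1F)                          ∎
        where open ≡-Reasoning

    private
      β = h 0F 1F

      -x≡0⇒x≡0 : ∀ x → - x ≡ 0F → x ≡ 0F
      -x≡0⇒x≡0 x -x≡0 = trans (sym (-‿involutive x)) (trans (cong -_ -x≡0) -0#≈0#)

      e+0^a*β≡0⇒e≡0 : ∀ e a → β ≡ 0F → e + 0F ^ a * β ≡ 0F → e ≡ 0F
      e+0^a*β≡0⇒e≡0 e a β≡0 eq = trans (sym (+-identityʳ e)) (trans (cong (e +_) (sym (trans (cong (0F ^ a *_) β≡0) (zeroʳ _)))) eq)

    module _ (low : ∀ (i : Fin (suc m)) → moment h (toℕ i) (m ∸ toℕ i) ≡ 0F)
             (high : ∀ (j : Fin (suc d)) → moment h (m +ℕ toℕ j) (suc n ∸ toℕ j) ≡ 0F) where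

      private
        low′ : ∀ k → k ≤ m → lineMoment h k + 0F ^ (m ∸ k) * β ≡ 0F
        low′ k k≤m = -x≡0⇒x≡0 _ (begin
          - (lineMoment h k + 0F ^ (m ∸ k) * β)   ≡⟨ moment-homogeneous (m ∸ k) k x^e≡1 ⟨
          moment h (m ∸ k) k                      ≡⟨ cong₂ (moment h) (sym toℕi≡m∸k) (trans (sym (ℕ.m∸[m∸n]≡n k≤m)) (cong (m ∸_) (sym toℕi≡m∸k))) ⟩
          moment h (toℕ i) (m ∸ toℕ i)            ≡⟨ low i ⟩
          0F                                      ∎)
          where
          open ≡-Reasoning
          i : Fin (suc m)
          i = fromℕ< (s≤s (ℕ.m∸n≤m m k))
          toℕi≡m∸k : toℕ i ≡ m ∸ k
          toℕi≡m∸k = toℕ-fromℕ< (s≤s (ℕ.m∸n≤m m k))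
          x^e≡1 : ∀ x → ¬ x ≡ 0F → x ^ (d +ℕ (m ∸ k) +ℕ k) ≡ 1F
          x^e≡1 x x≢0 = trans (cong (x ^_) (trans (ℕ.+-assoc d (m ∸ k) k) (trans (cong (d +ℕ_) (ℕ.m∸n+n≡m k≤m)) d+m≡p-1))) (fermat x x≢0)

        high′ : ∀ j → j ≤ d → lineMoment h (suc n ∸ j) + 0F ^ (m +ℕ j) * β ≡ 0F
        high′ j j≤d = -x≡0⇒x≡0 _ (begin
          - (lineMoment h (suc n ∸ j) + 0F ^ (m +ℕ j) * β) ≡⟨ moment-homogeneous (m +ℕ j) (suc n ∸ j) x^e≡1 ⟨
          moment h (m +ℕ j) (suc n ∸ j)                    ≡⟨ cong (λ u → moment h (m +ℕ u) (suc n ∸ u)) (toℕ-fromℕ< (s≤s j≤d)) ⟨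
          moment h (m +ℕ toℕ i) (suc n ∸ toℕ i)            ≡⟨ high i ⟩
          0F                                               ∎)
          where
          open ≡-Reasoning
          i : Fin (suc d)
          i = fromℕ< (s≤s j≤d)
          exponent≡2[p-1] : d +ℕ (m +ℕ j) +ℕ (suc n ∸ j) ≡ 2 ℕ.* suc n
          exponent≡2[p-1] = begin
            d +ℕ (m +ℕ j) +ℕ (suc n ∸ j)       ≡⟨ cong (_+ℕ (suc n ∸ j)) (ℕ.+-assoc d m j) ⟨
            d +ℕ m +ℕ j +ℕ (suc n ∸ j)         ≡⟨ ℕ.+-assoc (d +ℕ m) j (suc n ∸ j) ⟩
            d +ℕ m +ℕ (j +ℕ (suc n ∸ j))       ≡⟨ cong₂ _+ℕ_ d+m≡p-1 (ℕ.m+[n∸m]≡n (ℕ.≤-trans j≤d d≤p-1)) ⟩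
            suc n +ℕ suc n                     ≡⟨ cong (suc n +ℕ_) (ℕ.+-identityʳ (suc n)) ⟨
            2 ℕ.* suc n                        ∎
          x^e≡1 : ∀ x → ¬ x ≡ 0F → x ^ (d +ℕ (m +ℕ j) +ℕ (suc n ∸ j)) ≡ 1F
          x^e≡1 x x≢0 = trans (cong (x ^_) exponent≡2[p-1]) (fermat-multiple x 2 x≢0)

        lineMoment-m≡0 : lineMoment h m ≡ 0F
        lineMoment-m≡0 = begin
          lineMoment h m                                    ≡⟨ +-identityʳ _ ⟨
          lineMoment h m + 0F                               ≡⟨ cong (lineMoment h m +_) (trans (cong (_* β) 0^[m+d]≡0) (zeroˡ β)) ⟨
          lineMoment h m + 0F ^ (m +ℕ d) * β                ≡⟨ cong (λ e → lineMoment h e + 0F ^ (m +ℕ d) * β) (ℕ.m∸[m∸n]≡n m≤p-1) ⟨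
          lineMoment h (suc n ∸ (suc n ∸ m)) + 0F ^ (m +ℕ d) * β
                                                            ≡⟨ cong (λ e → lineMoment h (suc n ∸ e) + 0F ^ (m +ℕ d) * β) p-1∸m≡d ⟩
          lineMoment h (suc n ∸ d) + 0F ^ (m +ℕ d) * β      ≡⟨ high′ d ℕ.≤-refl ⟩
          0F                                                ∎
          where
          open ≡-Reasoning
          0^[m+d]≡0 : 0F ^ (m +ℕ d) ≡ 0F
          0^[m+d]≡0 = trans (cong (0F ^_) (trans (ℕ.+-comm m d) d+m≡p-1)) (0^suc n)

        β≡0 : β ≡ 0F
        β≡0 = begin
          β                                      ≡⟨ solve 2 (λ μ β → β := μ :+ con (ℤ.+ 1) :* β :- μ) refl (lineMoment h m) β ⟩
          lineMoment h m + 1F * β - lineMoment h m ≡⟨ cong (λ e → lineMoment h m + 0F ^ e * β - lineMoment h m) (ℕ.n∸n≡0 m) ⟨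
          lineMoment h m + 0F ^ (m ∸ m) * β - lineMoment h m ≡⟨ cong (_- lineMoment h m) (low′ m ℕ.≤-refl) ⟩
          0F - lineMoment h m                    ≡⟨ cong (λ u → 0F - u) lineMoment-m≡0 ⟩
          0F - 0F                                ≡⟨ -‿inverseʳ 0F ⟩
          0F                                     ∎
          where open ≡-Reasoning

        lineMoment≡0 : ∀ b → b ≤ suc n → lineMoment h b ≡ 0F
        lineMoment≡0 b b≤p-1 with b ℕ.≤? m
        ... | yes b≤m = e+0^a*β≡0⇒e≡0 _ (m ∸ b) β≡0 (low′ b b≤m)
        ... | no b≰m = trans (cong (lineMoment h) (sym (ℕ.m∸[m∸n]≡n b≤p-1))) (e+0^a*β≡0⇒e≡0 _ (m +ℕ (suc n ∸ b)) β≡0 (high′ (suc n ∸ b) p-1∸b≤d))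
          where
          p-1∸b≤d : suc n ∸ b ≤ d
          p-1∸b≤d = subst (suc n ∸ b ≤_) p-1∸m≡d (ℕ.∸-monoʳ-≤ (suc n) (ℕ.<⇒≤ (ℕ.≰⇒> b≰m)))

      homogeneous-moments≡0⇒≡0 : ∀ x y → h x y ≡ 0F
      homogeneous-moments≡0⇒≡0 fz fz = h00≡0
      homogeneous-moments≡0⇒≡0 fz (fs y) = trans (h-on-axis (fs y) (λ ())) (trans (cong (fs y ^ d *_) β≡0) (zeroʳ _))
      homogeneous-moments≡0⇒≡0 (fs x) y = begin
        h (fs x) y                              ≡⟨ cong (h (fs x)) y≡tx ⟩
        h (fs x) (t * fs x)                     ≡⟨ h-on-line (fs x) t (λ ()) ⟩
        fs x ^ d * h 1F t                       ≡⟨ cong (fs x ^ d *_) (moments≡0⇒≡0 (h 1F) lineMoment≡0 t) ⟩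
        fs x ^ d * 0F                           ≡⟨ zeroʳ _ ⟩
        0F                                      ∎
        where
        open ≡-Reasoning
        t = fs x ⁻¹ * y
        y≡tx : y ≡ t * fs x
        y≡tx = sym (trans (solve 3 (λ i y x → i :* y :* x := (x :* i) :* y) refl (fs x ⁻¹) y (fs x))
                          (trans (cong (_* y) (x*x⁻¹≡1 (fs x) (λ ()))) (*-identityˡ y)))

  moment-sub : ∀ f g a b → moment (λ x y → f x y - g x y) a b ≡ moment f a b - moment g a b
  moment-sub f g a b = begin
    ∑ (λ x → ∑ (λ y → (f x y - g x y) * monomial a b x y))
      ≡⟨ ∑-cong (λ x → ∑-cong (λ y → solve 3 (λ u v w → (u :- v) :* w := u :* w :+ :- (v :* w)) refl (f x y) (g x y) (monomial a b x y))) ⟩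
    ∑ (λ x → ∑ (λ y → f x y * monomial a b x y + - (g x y * monomial a b x y)))
      ≡⟨ ∑-cong (λ x → trans (∑-+ _ _) (cong (∑ (λ y → f x y * monomial a b x y) +_) (∑-neg _))) ⟩
    ∑ (λ x → ∑ (λ y → f x y * monomial a b x y) + - ∑ (λ y → g x y * monomial a b x y))
      ≡⟨ trans (∑-+ _ _) (cong (moment f a b +_) (∑-neg _)) ⟩
    moment f a b - moment g a b ∎
    where open ≡-Reasoning

  IsPhi-resp-≗W : ∀ {f g} w → f ≗W g → IsPhi d f w → IsPhi d g w
  IsPhi-resp-≗W {f} {g} w f≗g isPhi Q = begin
    pairV w Q           ≡⟨ isPhi Q ⟩
    pairW f (ι Q)       ≡⟨ pairW≡pair f (ι Q) ⟩
    pair f (ι Q)        ≡⟨ pair-cong f≗g (λ _ _ → refl) ⟩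
    pair g (ι Q)        ≡⟨ pairW≡pair g (ι Q) ⟨
    pairW g (ι Q)       ∎
    where open ≡-Reasoning

  -- The candidate preimage has the coefficients read off by the probes; f - ι P then has all
  -- the moments that force a homogeneous function to vanish.
  ker-φ⊆im-ι : ∀ f → InU d f → ∀ w → IsPhi d f w → w ≗V 0V → Σ (V d) (λ P → ι P ≗W f)
  ker-φ⊆im-ι f f∈U w isPhi w≗0 = P , λ x y → sym (x-y≡0⇒x≡y (f x y) (ι P x y) (homogeneous-moments≡0⇒≡0 h00≡0 h-homogeneous low high x y))
    where
    P : V d
    P j = pair (coefficientProbe d (toℕ j)) f
    h : W
    h x y = f x y - ι P x y
    h00≡0 : VanishesAt0 h
    h00≡0 = trans (cong (_- 0F) (proj₁ f∈U)) (-‿inverseʳ 0F)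
    h-homogeneous : Homogeneous d h
    h-homogeneous l x y l≢0 = trans (cong₂ _-_ (InU⇒Homogeneous {d} f∈U l x y l≢0) (ι-homogeneous P l x y l≢0))
                                    (solve 3 (λ L a b → L :* a :- L :* b := L :* (a :- b)) refl (l ^ d) (f x y) (ι P x y))
    low : ∀ (i : Fin (suc m)) → moment h (toℕ i) (m ∸ toℕ i) ≡ 0F
    low i = begin
      moment h (toℕ i) (m ∸ toℕ i)                                   ≡⟨ moment-sub f (ι P) (toℕ i) (m ∸ toℕ i) ⟩
      moment f (toℕ i) (m ∸ toℕ i) - moment (ι P) (toℕ i) (m ∸ toℕ i) ≡⟨ cong₂ _-_ (sym (IsPhi⇒MomentsMatch f w (proj₁ f∈U) isPhi i))
                                                                                    (moment-ι-complementary P (toℕ i) (m ∸ toℕ i) (ℕ.m+[n∸m]≡n (ℕ.≤-pred (toℕ<n i)))) ⟩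
      weight i * w i - 0F                                            ≡⟨ cong (λ u → weight i * u - 0F) (w≗0 i) ⟩
      weight i * 0F - 0F                                             ≡⟨ solve 1 (λ u → u :* con (ℤ.+ 0) :- con (ℤ.+ 0) := con (ℤ.+ 0)) refl (weight i) ⟩
      0F                                                             ∎
      where open ≡-Reasoning
    high : ∀ (j : Fin (suc d)) → moment h (m +ℕ toℕ j) (suc n ∸ toℕ j) ≡ 0F
    high j = begin
      moment h (m +ℕ toℕ j) (suc n ∸ toℕ j)                          ≡⟨ moment-sub f (ι P) (m +ℕ toℕ j) (suc n ∸ toℕ j) ⟩
      pair f (coefficientProbe d (toℕ j)) - pair (ι P) (coefficientProbe d (toℕ j))
                                                                     ≡⟨ cong₂ _-_ (pair-comm f _) (pair-comm (ι P) _) ⟩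
      P j - pair (coefficientProbe d (toℕ j)) (ι P)                  ≡⟨ cong (λ u → P j - u) (pair-coefficientProbe-ι P d≤p-1 j) ⟩
      P j - P j                                                      ≡⟨ -‿inverseʳ (P j) ⟩
      0F                                                             ∎
      where open ≡-Reasoning

  im-ι⊆ker-φ : ∀ f → VanishesAt0 f → ∀ w → IsPhi d f w → Σ (V d) (λ P → ι P ≗W f) → w ≗V 0V
  im-ι⊆ker-φ f f00≡0 w isPhi (P , ιP≗f) = IsPhi-unique f w 0V f00≡0 isPhi (IsPhi-resp-≗W 0V ιP≗f (φ∘ι≡0 P))

module Equivariance (n : ℕ) (isPrime : Prime (suc (suc n))) (d : ℕ) (d≤p-1 : d ≤ suc n) where

  open Duality n isPrime d d≤p-1 public

  ofℤ-det : ∀ a b c e → ofℤ (det (mat a b c e)) ≡ ofℤ a * ofℤ e - ofℤ b * ofℤ c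
  ofℤ-det a b c e = begin
    ofℤ ((a ℤ.* e) ℤ.+ ℤ.- (b ℤ.* c))           ≡⟨ ofℤ-+ (a ℤ.* e) (ℤ.- (b ℤ.* c)) ⟩
    ofℤ (a ℤ.* e) + ofℤ (ℤ.- (b ℤ.* c))         ≡⟨ cong₂ _+_ (ofℤ-* a e) (trans (ofℤ-neg (b ℤ.* c)) (cong -_ (ofℤ-* b c))) ⟩
    ofℤ a * ofℤ e - ofℤ b * ofℤ c               ∎
    where open ≡-Reasoning

  actW-mat : ∀ a b c e f x y → actW (mat a b c e) f x y ≡ f (x * ofℤ a + y * ofℤ c) (x * ofℤ b + y * ofℤ e)
  actW-mat a b c e f x y = cong₂ f (+F≡*+* (ofℤ a) (ofℤ c)) (+F≡*+* (ofℤ b) (ofℤ e))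
    where
    +F≡*+* : ∀ u v → (x *F u) +F (y *F v) ≡ x * u + y * v
    +F≡*+* u v = trans (+F≡+ _ _) (cong₂ _+_ (*F≡* x u) (*F≡* y v))

  linear-kernel-trivial : ∀ α β γ δ x y → ¬ α * δ - β * γ ≡ 0F → α * x + γ * y ≡ 0F → β * x + δ * y ≡ 0F → x ≡ 0F × y ≡ 0F
  linear-kernel-trivial α β γ δ x y Δ≢0 X≡0 Y≡0 = vanishes x x*Δ≡0 , vanishes y y*Δ≡0
    where
    open ≡-Reasoning
    Δ = α * δ - β * γ
    vanishes : ∀ z → z * Δ ≡ 0F → z ≡ 0F
    vanishes z z*Δ≡0 = [ (λ z≡0 → z≡0) , ⊥-elim ∘ Δ≢0 ]′ (x*y≡0⇒x≡0∨y≡0 z Δ z*Δ≡0)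
    x*Δ≡0 : x * Δ ≡ 0F
    x*Δ≡0 = begin
      x * Δ                                       ≡⟨ solve 6 (λ x y α β γ δ → x :* (α :* δ :- β :* γ) := δ :* (α :* x :+ γ :* y) :- γ :* (β :* x :+ δ :* y)) refl x y α β γ δ ⟩
      δ * (α * x + γ * y) - γ * (β * x + δ * y)   ≡⟨ cong₂ (λ u v → δ * u - γ * v) X≡0 Y≡0 ⟩
      δ * 0F - γ * 0F                             ≡⟨ solve 2 (λ δ γ → δ :* con (ℤ.+ 0) :- γ :* con (ℤ.+ 0) := con (ℤ.+ 0)) refl δ γ ⟩
      0F                                          ∎
    y*Δ≡0 : y * Δ ≡ 0F
    y*Δ≡0 = begin
      y * Δ                                       ≡⟨ solve 6 (λ x y α β γ δ → y :* (α :* δ :- β :* γ) := α :* (β :* x :+ δ :* y) :- β :* (α :* x :+ γ :* y)) refl x y α β γ δ ⟩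
      α * (β * x + δ * y) - β * (α * x + γ * y)   ≡⟨ cong₂ (λ u v → α * u - β * v) Y≡0 X≡0 ⟩
      α * 0F - β * 0F                             ≡⟨ solve 2 (λ α β → α :* con (ℤ.+ 0) :- β :* con (ℤ.+ 0) := con (ℤ.+ 0)) refl α β ⟩
      0F                                          ∎

  module _ {k} (a b c e : ℤ.ℤ) (P : V k)
           (collapse : ∀ x y → NonOrigin x y → ofℤ a * x + ofℤ c * y ≡ 0F → ofℤ b * x + ofℤ e * y ≡ 0F → ev P 0F 0F ≡ 0F) where

    private
      α = ofℤ a
      β = ofℤ b
      γ = ofℤ c
      δ = ofℤ e

      ι-actV-off-origin : ∀ x y → NonOrigin x y → ι (actV (mat a b c e) P) x y ≡ actW (mat a b c e) (ι P) x y
      ι-actV-off-origin x y x,y≢0 = begin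
        ι (actV (mat a b c e) P) x y            ≡⟨ ι-ev _ x y x,y≢0 ⟩
        ev (actV (mat a b c e) P) x y           ≡⟨ ev-actV a b c e P x y ⟩
        ev P (α * x + γ * y) (β * x + δ * y)    ≡⟨ ι≡ev-unless-origin P _ _ (λ X≡0 Y≡0 → trans (cong₂ (ev P) X≡0 Y≡0) (collapse x y x,y≢0 X≡0 Y≡0)) ⟨
        ι P (α * x + γ * y) (β * x + δ * y)     ≡⟨ cong₂ (ι P) (cong₂ _+_ (*-comm α x) (*-comm γ y)) (cong₂ _+_ (*-comm β x) (*-comm δ y)) ⟩
        ι P (x * α + y * γ) (x * β + y * δ)     ≡⟨ actW-mat a b c e (ι P) x y ⟨
        actW (mat a b c e) (ι P) x y            ∎
        where open ≡-Reasoning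

    ι-actV : ι (actV (mat a b c e) P) ≗W actW (mat a b c e) (ι P)
    ι-actV fz fz = sym (trans (actW-mat a b c e (ι P) fz fz) (cong₂ (ι P) (0*u+0*v≡0 α γ) (0*u+0*v≡0 β δ)))
      where
      0*u+0*v≡0 : ∀ u v → 0F * u + 0F * v ≡ 0F
      0*u+0*v≡0 = solve 2 (λ u v → con (ℤ.+ 0) :* u :+ con (ℤ.+ 0) :* v := con (ℤ.+ 0)) refl
    ι-actV fz (fs y) = ι-actV-off-origin fz (fs y) (λ ())
    ι-actV (fs x) y = ι-actV-off-origin (fs x) y (λ ())

  ι-equivariant : ∀ M → ¬ ofℤ (det M) ≡ 0F → ∀ (P : V d) → ι (actV M P) ≗W actW M (ι P)
  ι-equivariant (mat a b c e) det≢0 P = ι-actV a b c e P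
    (λ x y x,y≢0 X≡0 Y≡0 → ⊥-elim (x,y≢0 (linear-kernel-trivial (ofℤ a) (ofℤ b) (ofℤ c) (ofℤ e) x y
                                             (det≢0 ∘ trans (ofℤ-det a b c e)) X≡0 Y≡0)))

  -- Coefficients of (t X - s Y)^m, i.e. of the m-th power of the linear form v ↦ det(v | (s,t)).
  detPower : F → F → V m
  detPower s t k = ⟪ m C toℕ k ⟫ * (t ^ (m ∸ toℕ k) * (- s) ^ toℕ k)

  ev-detPower : ∀ s t x y → ev (detPower s t) x y ≡ (t * x + - s * y) ^ m
  ev-detPower s t x y = sym (begin
    (t * x + - s * y) ^ m                        ≡⟨ cong (_^ m) (+-comm (t * x) (- s * y)) ⟩
    (- s * y + t * x) ^ m                        ≡⟨ binomial (- s * y) (t * x) m ⟩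
    ∑ (λ k → ⟪ m C toℕ k ⟫ * ((- s * y) ^ toℕ k * (t * x) ^ (m ∸ toℕ k)))
                                                 ≡⟨ ∑-cong term ⟩
    ev (detPower s t) x y                        ∎)
    where
    open ≡-Reasoning
    term : ∀ k → ⟪ m C toℕ k ⟫ * ((- s * y) ^ toℕ k * (t * x) ^ (m ∸ toℕ k)) ≡ detPower s t k * (x ^ (m ∸ toℕ k) * y ^ toℕ k)
    term k = trans (cong₂ (λ u v → ⟪ m C toℕ k ⟫ * (u * v)) (^-distrib-* (- s) y (toℕ k)) (^-distrib-* t x (m ∸ toℕ k)))
      (solve 5 (λ c a b e f → c :* ((a :* b) :* (e :* f)) := (c :* (e :* a)) :* (f :* b)) refl
             ⟪ m C toℕ k ⟫ ((- s) ^ toℕ k) (y ^ toℕ k) (t ^ (m ∸ toℕ k)) (x ^ (m ∸ toℕ k)))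

  pairV-detPower : ∀ (w : V m) s t → pairV w (detPower s t) ≡ (- 1F) ^ m * ev w s t
  pairV-detPower w s t = trans (pairV≡weighted w (detPower s t)) (trans (∑-cong term) (∑-*ˡ ((- 1F) ^ m) _))
    where
    term : ∀ i → (weight i * w i) * detPower s t (opposite i) ≡ (- 1F) ^ m * (w i * (s ^ (m ∸ toℕ i) * t ^ toℕ i))
    term i = begin
      (weight i * w i) * (⟪ m C toℕ (opposite i) ⟫ * (t ^ (m ∸ toℕ (opposite i)) * (- s) ^ toℕ (opposite i)))
        ≡⟨ cong (λ u → (weight i * w i) * (⟪ m C u ⟫ * (t ^ (m ∸ u) * (- s) ^ u))) (opposite-prop i) ⟩
      (weight i * w i) * (⟪ m C (m ∸ toℕ i) ⟫ * (t ^ (m ∸ (m ∸ toℕ i)) * (- s) ^ (m ∸ toℕ i)))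
        ≡⟨ cong₂ (λ u v → (weight i * w i) * (⟪ u ⟫ * (t ^ v * (- s) ^ (m ∸ toℕ i)))) (sym (nCk≡nC[n∸k] i≤m)) (ℕ.m∸[m∸n]≡n i≤m) ⟩
      ((σ * c ⁻¹) * w i) * (c * (t ^ toℕ i * (- s) ^ (m ∸ toℕ i)))
        ≡⟨ cong (λ u → ((σ * c ⁻¹) * w i) * (c * (t ^ toℕ i * u))) (neg^ s (m ∸ toℕ i)) ⟩
      ((σ * c ⁻¹) * w i) * (c * (t ^ toℕ i * ((- 1F) ^ (m ∸ toℕ i) * s ^ (m ∸ toℕ i))))
        ≡⟨ solve 7 (λ g ic w c T G S → ((g :* ic) :* w) :* (c :* (T :* (G :* S))) := (ic :* c) :* ((g :* G) :* (w :* (S :* T)))) refl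
                   σ (c ⁻¹) (w i) c (t ^ toℕ i) ((- 1F) ^ (m ∸ toℕ i)) (s ^ (m ∸ toℕ i)) ⟩
      (c ⁻¹ * c) * ((σ * (- 1F) ^ (m ∸ toℕ i)) * (w i * (s ^ (m ∸ toℕ i) * t ^ toℕ i)))
        ≡⟨ cong₂ (λ u v → u * (v * (w i * (s ^ (m ∸ toℕ i) * t ^ toℕ i))))
                 (x⁻¹*x≡1 c (⟪mCi⟫≢0 i))
                 (trans (sym (^-homo-* (- 1F) (toℕ i) (m ∸ toℕ i))) (cong ((- 1F) ^_) (ℕ.m+[n∸m]≡n i≤m))) ⟩
      1F * ((- 1F) ^ m * (w i * (s ^ (m ∸ toℕ i) * t ^ toℕ i)))
        ≡⟨ *-identityˡ _ ⟩
      (- 1F) ^ m * (w i * (s ^ (m ∸ toℕ i) * t ^ toℕ i)) ∎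
      where
      open ≡-Reasoning
      i≤m : toℕ i ≤ m
      i≤m = ℕ.≤-pred (toℕ<n i)
      σ = (- 1F) ^ toℕ i
      c = ⟪ m C toℕ i ⟫

  pairWithDetPower : W → F → F → F
  pairWithDetPower g s t = pair g (λ x y → (t * x + - s * y) ^ m)

  ev-IsPhi : ∀ g (w : V m) → VanishesAt0 g → IsPhi d g w → ∀ s t → ev w s t ≡ (- 1F) ^ m * pairWithDetPower g s t
  ev-IsPhi g w g00≡0 isPhi s t = begin
    ev w s t                                         ≡⟨ trans (sym (*-identityˡ _)) (cong (_* ev w s t) (sym (-1^*-1^ m))) ⟩
    (- 1F) ^ m * (- 1F) ^ m * ev w s t               ≡⟨ *-assoc _ _ _ ⟩
    (- 1F) ^ m * ((- 1F) ^ m * ev w s t)             ≡⟨ cong ((- 1F) ^ m *_) (pairV-detPower w s t) ⟨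
    (- 1F) ^ m * pairV w (detPower s t)              ≡⟨ cong ((- 1F) ^ m *_) (isPhi (detPower s t)) ⟩
    (- 1F) ^ m * pairW g (ι (detPower s t))          ≡⟨ cong ((- 1F) ^ m *_) (trans (pairW≡pair g _) (pair-ι g (detPower s t) g00≡0)) ⟩
    (- 1F) ^ m * pair g (ev (detPower s t))          ≡⟨ cong ((- 1F) ^ m *_) (pair-cong (λ _ _ → refl) (ev-detPower s t)) ⟩
    (- 1F) ^ m * pairWithDetPower g s t              ∎
    where open ≡-Reasoning

  -- The substitution (x,y) ↦ (x,y)M multiplies det(v | (s,t)) by det M, and det M^(d+m) = 1 by Fermat.
  pairWithDetPower-actW : ∀ a b c e f → ¬ ofℤ (det (mat a b c e)) ≡ 0F → ∀ s t →
    pairWithDetPower (actW (mat a b c e) f) s t ≡ ofℤ (det (mat a b c e)) ^ d * pairWithDetPower f (ofℤ a * s + ofℤ c * t) (ofℤ b * s + ofℤ e * t)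
  pairWithDetPower-actW a b c e f det≢0 s t = begin
    pairWithDetPower (actW (mat a b c e) f) s t                              ≡⟨ pair-cong (actW-mat a b c e f) (λ _ _ → refl) ⟩
    ∑ (λ x → ∑ (λ y → f (X x y) (Y x y) * L x y))                            ≡⟨ sym (*-identityˡ _) ⟩
    1F * ∑ (λ x → ∑ (λ y → f (X x y) (Y x y) * L x y))                       ≡⟨ cong (_* ∑ (λ x → ∑ (λ y → f (X x y) (Y x y) * L x y))) Δ^d*Δ^m≡1 ⟨
    (Δ ^ d * Δ ^ m) * ∑ (λ x → ∑ (λ y → f (X x y) (Y x y) * L x y))          ≡⟨ *-assoc _ _ _ ⟩
    Δ ^ d * (Δ ^ m * ∑ (λ x → ∑ (λ y → f (X x y) (Y x y) * L x y)))          ≡⟨ cong (Δ ^ d *_) (trans (sym (∑-*ˡ _ _)) (∑-cong (λ x → sym (∑-*ˡ _ _)))) ⟩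
    Δ ^ d * ∑ (λ x → ∑ (λ y → Δ ^ m * (f (X x y) (Y x y) * L x y)))          ≡⟨ cong (Δ ^ d *_) (∑-cong (λ x → ∑-cong (λ y → pointwise x y))) ⟩
    Δ ^ d * ∑ (λ x → ∑ (λ y → G (X x y) (Y x y)))                            ≡⟨ cong (Δ ^ d *_) (∑²-linear α β γ δ Δ≢0 G) ⟩
    Δ ^ d * ∑ (λ x → ∑ (G x))                                                ≡⟨ cong (λ u → u ^ d * ∑ (λ x → ∑ (G x))) (ofℤ-det a b c e) ⟨
    ofℤ (det (mat a b c e)) ^ d * pairWithDetPower f (α * s + γ * t) (β * s + δ * t) ∎
    where
    open ≡-Reasoning
    α = ofℤ a
    β = ofℤ b
    γ = ofℤ c
    δ = ofℤ e
    Δ = α * δ - β * γ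
    Δ≢0 : ¬ Δ ≡ 0F
    Δ≢0 = det≢0 ∘ trans (ofℤ-det a b c e)
    Δ^d*Δ^m≡1 : Δ ^ d * Δ ^ m ≡ 1F
    Δ^d*Δ^m≡1 = trans (sym (^-homo-* Δ d m)) (trans (cong (Δ ^_) d+m≡p-1) (fermat Δ Δ≢0))
    X Y : F → F → F
    X x y = x * α + y * γ
    Y x y = x * β + y * δ
    L : F → F → F
    L x y = (t * x + - s * y) ^ m
    G : F → F → F
    G x′ y′ = f x′ y′ * ((β * s + δ * t) * x′ + - (α * s + γ * t) * y′) ^ m
    pointwise : ∀ x y → Δ ^ m * (f (X x y) (Y x y) * L x y) ≡ G (X x y) (Y x y)
    pointwise x y = begin
      Δ ^ m * (f (X x y) (Y x y) * L x y)           ≡⟨ solve 3 (λ a u v → a :* (u :* v) := u :* (a :* v)) refl (Δ ^ m) (f (X x y) (Y x y)) (L x y) ⟩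
      f (X x y) (Y x y) * (Δ ^ m * L x y)           ≡⟨ cong (f (X x y) (Y x y) *_) (^-distrib-* Δ _ m) ⟨
      f (X x y) (Y x y) * (Δ * (t * x + - s * y)) ^ m
        ≡⟨ cong (λ u → f (X x y) (Y x y) * u ^ m)
                (solve 8 (λ α β γ δ s t x y → (α :* δ :- β :* γ) :* (t :* x :+ (:- s) :* y)
                                               := (β :* s :+ δ :* t) :* (x :* α :+ y :* γ) :+ (:- (α :* s :+ γ :* t)) :* (x :* β :+ y :* δ))
                       refl α β γ δ s t x y) ⟩
      G (X x y) (Y x y)                             ∎

  ev-scaleV : ∀ {k} c (P : V k) x y → ev (scaleV c P) x y ≡ c * ev P x y
  ev-scaleV c P x y = trans (∑-cong (λ i → trans (cong (_* _) (*F≡* c (P i))) (*-assoc _ _ _))) (∑-*ˡ c _)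

  φ-equivariant : ∀ M → ¬ ofℤ (det M) ≡ 0F → ∀ f → VanishesAt0 f → ∀ (w : V m) → IsPhi d f w →
                  IsPhi d (actW M f) (scaleV (ofℤ (det M) ^F d) (actV M w))
  φ-equivariant (mat a b c e) det≢0 f f00≡0 w isPhi =
    IsPhi-resp-≗V Mf (φ Mf) w′ Mf00≡0 (ι-injective (φ Mf) w′ m≤p-1 (ev≗⇒ι≗ (φ Mf) w′ ev≡)) (φ-IsPhi Mf Mf00≡0)
    where
    M = mat a b c e
    Mf = actW M f
    Mf00≡0 : VanishesAt0 Mf
    Mf00≡0 = trans (actW-mat a b c e f 0F 0F) (trans (cong₂ f (0*u+0*v≡0 (ofℤ a) (ofℤ c)) (0*u+0*v≡0 (ofℤ b) (ofℤ e))) f00≡0)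
      where
      0*u+0*v≡0 : ∀ u v → 0F * u + 0F * v ≡ 0F
      0*u+0*v≡0 = solve 2 (λ u v → con (ℤ.+ 0) :* u :+ con (ℤ.+ 0) :* v := con (ℤ.+ 0)) refl
    w′ = scaleV (ofℤ (det M) ^F d) (actV M w)
    ev≡ : ∀ s t → ev (φ Mf) s t ≡ ev w′ s t
    ev≡ s t = begin
      ev (φ Mf) s t                              ≡⟨ ev-IsPhi Mf (φ Mf) Mf00≡0 (φ-IsPhi Mf Mf00≡0) s t ⟩
      (- 1F) ^ m * pairWithDetPower Mf s t       ≡⟨ cong ((- 1F) ^ m *_) (pairWithDetPower-actW a b c e f det≢0 s t) ⟩
      (- 1F) ^ m * (D ^ d * pairWithDetPower f s′ t′)
                                                 ≡⟨ solve 3 (λ g D k → g :* (D :* k) := D :* (g :* k)) refl ((- 1F) ^ m) (D ^ d) _ ⟩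
      D ^ d * ((- 1F) ^ m * pairWithDetPower f s′ t′)
                                                 ≡⟨ cong₂ _*_ (sym (^F≡^ D d)) (sym (ev-IsPhi f w f00≡0 isPhi s′ t′)) ⟩
      (D ^F d) * ev w s′ t′                        ≡⟨ cong ((D ^F d) *_) (ev-actV a b c e w s t) ⟨
      (D ^F d) * ev (actV M w) s t               ≡⟨ ev-scaleV (D ^F d) (actV M w) s t ⟨
      ev w′ s t                                  ∎
      where
      open ≡-Reasoning
      D = ofℤ (det M)
      s′ = ofℤ a * s + ofℤ c * t
      t′ = ofℤ b * s + ofℤ e * t

  module _ (0<d : 0 < d) where

    ι-equivariant-diagP1 : ∀ (P : V d) → ι (actV (diagP1 p) P) ≗W actW (diagP1 p) (ι P)
    ι-equivariant-diagP1 P = ι-actV (ℤ.+ p) (ℤ.+ 0) (ℤ.+ 0) (ℤ.+ 1) P (λ _ _ _ _ _ → ev-origin P 0<d)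

    actW-diagP1 : ∀ f x y → actW (diagP1 p) f x y ≡ f 0F y
    actW-diagP1 f x y = begin
      actW (diagP1 p) f x y                                                       ≡⟨ actW-mat (ℤ.+ p) (ℤ.+ 0) (ℤ.+ 0) (ℤ.+ 1) f x y ⟩
      f (x * ofℤ (ℤ.+ p) + y * ofℤ (ℤ.+ 0)) (x * ofℤ (ℤ.+ 0) + y * ofℤ (ℤ.+ 1))    ≡⟨ cong (λ u → f (x * u + y * 0F) (x * 0F + y * 1F)) (trans (ofℤ-+ℕ p) ⟪p⟫) ⟩
      f (x * 0F + y * 0F) (x * 0F + y * 1F)                                       ≡⟨ cong₂ f (solve 2 (λ x y → x :* con (ℤ.+ 0) :+ y :* con (ℤ.+ 0) := con (ℤ.+ 0)) refl x y)
                                                                                             (solve 2 (λ x y → x :* con (ℤ.+ 0) :+ y :* con (ℤ.+ 1) := y) refl x y) ⟩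
      f 0F y                                                                      ∎
      where open ≡-Reasoning

    φ-actW-diagP1≡0 : ∀ f → VanishesAt0 f → IsPhi d (actW (diagP1 p) f) 0V
    φ-actW-diagP1≡0 f f00≡0 = MomentsMatch⇒IsPhi (actW (diagP1 p) f) 0V (trans (actW-diagP1 f 0F 0F) f00≡0) (λ i → trans (zeroʳ _) (sym (moment≡0 i)))
      where
      m<p-1 : m < suc n
      m<p-1 = ℕ.∸-monoʳ-< 0<d d≤p-1
      moment≡0 : ∀ (i : Fin (suc m)) → moment (actW (diagP1 p) f) (toℕ i) (m ∸ toℕ i) ≡ 0F
      moment≡0 i = begin
        moment (actW (diagP1 p) f) a b                          ≡⟨ pair-cong (actW-diagP1 f) (λ _ _ → refl) ⟩
        ∑ (λ x → ∑ (λ y → f 0F y * (x ^ a * y ^ b)))            ≡⟨ ∑-cong (λ x → trans (∑-cong (λ y → regroup x y)) (∑-*ˡ _ _)) ⟩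
        ∑ (λ x → x ^ a * ∑ (λ y → f 0F y * y ^ b))              ≡⟨ ∑-*ʳ _ _ ⟩
        S a * ∑ (λ y → f 0F y * y ^ b)                          ≡⟨ cong (_* ∑ (λ y → f 0F y * y ^ b)) (S≡0 a (ℕ.≤-<-trans (ℕ.≤-pred (toℕ<n i)) m<p-1)) ⟩
        0F * ∑ (λ y → f 0F y * y ^ b)                           ≡⟨ zeroˡ _ ⟩
        0F                                                      ∎
        where
        open ≡-Reasoning
        a = toℕ i
        b = m ∸ toℕ i
        regroup : ∀ x y → f 0F y * (x ^ a * y ^ b) ≡ x ^ a * (f 0F y * y ^ b)
        regroup x y = solve 3 (λ u v w → u :* (v :* w) := v :* (u :* w)) refl (f 0F y) (x ^ a) (y ^ b)

    φ-equivariant-diagP1 : ∀ f → VanishesAt0 f → ∀ (w : V m) →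
                           IsPhi d (actW (diagP1 p) f) (scaleV (ofℤ (det (diagP1 p)) ^F d) (actV (diagP1 p) w))
    φ-equivariant-diagP1 f f00≡0 w = IsPhi-resp-≗V (actW (diagP1 p) f) 0V _ (trans (actW-diagP1 f 0F 0F) f00≡0) (λ j → sym (scaled≡0 j)) (φ-actW-diagP1≡0 f f00≡0)
      where
      det≡0 : ofℤ (det (diagP1 p)) ≡ 0F
      det≡0 = begin
        ofℤ (det (diagP1 p))                                  ≡⟨ ofℤ-det (ℤ.+ p) (ℤ.+ 0) (ℤ.+ 0) (ℤ.+ 1) ⟩
        ofℤ (ℤ.+ p) * ofℤ (ℤ.+ 1) - ofℤ (ℤ.+ 0) * ofℤ (ℤ.+ 0) ≡⟨ cong (λ u → u * 1F - 0F * 0F) (trans (ofℤ-+ℕ p) ⟪p⟫) ⟩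
        0F * 1F - 0F * 0F                                     ≡⟨ solve 0 (con (ℤ.+ 0) :* con (ℤ.+ 1) :- con (ℤ.+ 0) :* con (ℤ.+ 0) := con (ℤ.+ 0)) refl ⟩
        0F                                                    ∎
        where open ≡-Reasoning
      scaled≡0 : ∀ j → scaleV (ofℤ (det (diagP1 p)) ^F d) (actV (diagP1 p) w) j ≡ 0F
      scaled≡0 j = begin
        (ofℤ (det (diagP1 p)) ^F d) *F actV (diagP1 p) w j     ≡⟨ *F≡* _ _ ⟩
        (ofℤ (det (diagP1 p)) ^F d) * actV (diagP1 p) w j      ≡⟨ cong (_* actV (diagP1 p) w j) (trans (^F≡^ _ d) (cong (_^ d) det≡0)) ⟩
        0F ^ d * actV (diagP1 p) w j                           ≡⟨ cong (_* actV (diagP1 p) w j) (0^positive d 0<d) ⟩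
        0F * actV (diagP1 p) w j                               ≡⟨ zeroˡ _ ⟩
        0F                                                     ∎
        where
        open ≡-Reasoning
        0^positive : ∀ k → 0 < k → 0F ^ k ≡ 0F
        0^positive (suc k) _ = 0^suc k

proposition4p1 : (p : ℕ) .{{_ : NonZero p}} → Prime p → (d : ℕ) → d ≤ p ∸ 1 →
  let open Fp p in
  -- ι lands in U_d
  (∀ (P : V d) → InU d (ι P))
  -- ι is injective
  × (∀ (P P′ : V d) → ι P ≗W ι P′ → P ≗V P′)
  -- φ is well defined on U_d (existence and uniqueness of φ(f))
  × (∀ f → InU d f → Σ (V (p ∸ 1 ∸ d)) (λ w → IsPhi d f w)
       × (∀ w w′ → IsPhi d f w → IsPhi d f w′ → w ≗V w′))
  -- exactness in the middle: ker φ = im ι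
  × (∀ f → InU d f → ∀ w → IsPhi d f w → ((w ≗V 0V) ⇔ Σ (V d) (λ P → ι P ≗W f)))
  -- φ is surjective
  × (∀ (w : V (p ∸ 1 ∸ d)) → Σ W (λ f → InU d f × IsPhi d f w))
  -- equivariance for M ∈ Mat₂(ℤ)_{≠0} invertible mod p
  × (∀ M → NonSingular M → ¬ (ofℤ (det M) ≡ 0F) →
       (∀ (P : V d) → ι (actV M P) ≗W actW M (ι P))
       × (∀ f → InU d f → ∀ w → IsPhi d f w →
            IsPhi d (actW M f) (scaleV (ofℤ (det M) ^F d) (actV M w))))
  -- the case M = (p 0 ; 0 1) when d > 0
  × (0 < d →
       (∀ (P : V d) → ι (actV (diagP1 p) P) ≗W actW (diagP1 p) (ι P))
       × (∀ f → InU d f → ∀ w → IsPhi d f w →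
            IsPhi d (actW (diagP1 p) f)
                    (scaleV (ofℤ (det (diagP1 p)) ^F d) (actV (diagP1 p) w)))
       × (∀ f → InU d f → ∀ w → IsPhi d f w → IsPhi d (actW (diagP1 p) f) 0V))
proposition4p1 zero isPrime _ _ = ⊥-elim (¬prime[0] isPrime)
proposition4p1 (suc zero) isPrime _ _ = ⊥-elim (¬prime[1] isPrime)
proposition4p1 (suc (suc n)) isPrime d d≤p-1 =
    ι∈U
  , (λ P Q → ι-injective P Q d≤p-1)
  , (λ f f∈U → (φ f , φ-IsPhi f (proj₁ f∈U)) , (λ w w′ → IsPhi-unique f w w′ (proj₁ f∈U)))
  , (λ f f∈U w isPhi → mk⇔ (ker-φ⊆im-ι f f∈U w isPhi) (im-ι⊆ker-φ f (proj₁ f∈U) w isPhi))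
  , φ-surjective
  , (λ M _ det≢0 → ι-equivariant M det≢0 , λ f f∈U → φ-equivariant M det≢0 f (proj₁ f∈U))
  , (λ 0<d → ι-equivariant-diagP1 0<d
           , (λ f f∈U w _ → φ-equivariant-diagP1 0<d f (proj₁ f∈U) w)
           , (λ f f∈U _ _ → φ-actW-diagP1≡0 0<d f (proj₁ f∈U)))
  where open Equivariance n isPrime d d≤p-1
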